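{- Let $n\ge 4$ and let $a,b$ be integers with $b\ge a\ge 0$ and $a+b=n-4$. Then the $\mathcal{E}$-spectrum of $(T_{n,3}^{a,b})^c$ consists of the four simple eigenvalues $$\pm\sqrt{\frac{4n+1+\sqrt{(4n+1)^2-64(a+1)(b+1)}}{2}},\qquad \pm\sqrt{\frac{4n+1-\sqrt{(4n+1)^2-64(a+1)(b+1)}}{2}},$$ together with the eigenvalue $0$ of multiplicity $n-4$.
   Context: For a connected graph $G$, $d_G(u,v)$ is the distance between $u$ and $v$ and $e_G(u)=\max_{v}d_G(u,v)$ is the eccentricity of $u$. The eccentricity matrix $\mathcal{E}(G)$ is the matrix indexed by $V(G)$ whose $(u,v)$-entry is $d_G(u,v)$ if $d_G(u,v)=\min\{e_G(u),e_G(v)\}$ and $0$ otherwise; its eigenvalues (with multiplicity) form the $\mathcal{E}$-spectrum of $G$. For a graph $T$, $T^c$ denotes its complement. For $b\ge a\ge 0$ with $a+b=n-4$, $T_{n,3}^{a,b}$ is the tree on $n$ vertices obtained from the path $v_0v_1v_2v_3$ by attaching $a$ pendant vertices to $v_1$ and $b$ pendant vertices to $v_2$. -}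

module Defs where

open import Data.Bool using (Bool; true; false; if_then_else_; _∧_; _∨_; not)
open import Data.Nat using (ℕ; zero; suc; _+_; _*_; _≤ᵇ_; _<ᵇ_; _≡ᵇ_; _⊔_; _⊓_)
open import Data.Fin using (Fin; zero; suc; toℕ; punchIn)
import Data.Integer
open import Data.Integer using (ℤ; +_; -_) renaming (_+_ to _+ℤ_; _*_ to _*ℤ_)
open import Data.List using (List; []; _∷_; replicate; _++_)
open import Relation.Binary.PropositionalEquality using (_≡_)

Graph : ℕ → Set
Graph n = Fin n → Fin n → Bool

_==_ : {n : ℕ} → Fin n → Fin n → Bool
u == v = toℕ u ≡ᵇ toℕ v

complement : {n : ℕ} → Graph n → Graph n
complement G u v = not (u == v) ∧ not (G u v)

anyF : {n : ℕ} → (Fin n → Bool) → Bool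
anyF {zero}  f = false
anyF {suc n} f = f zero ∨ anyF (λ i → f (suc i))

maxF : {n : ℕ} → (Fin n → ℕ) → ℕ
maxF {zero}  f = 0
maxF {suc n} f = f zero ⊔ maxF (λ i → f (suc i))

reach : {n : ℕ} → Graph n → ℕ → Fin n → Fin n → Bool
reach G zero    u v = u == v
reach G (suc k) u v = reach G k u v ∨ anyF (λ w → reach G k u w ∧ G w v)

search : (ℕ → Bool) → ℕ → ℕ → ℕ
search p k zero     = k
search p k (suc f)  = if p k then k else search p (suc k) f

-- distance d_G(u,v): the least k with a walk of length k from u to v
-- (for connected graphs on n vertices such k < n always exists)
dist : {n : ℕ} → Graph n → Fin n → Fin n → ℕ
dist {n} G u v = search (λ k → reach G k u v) 0 n

ecc : {n : ℕ} → Graph n → Fin n → ℕ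
ecc G u = maxF (λ v → dist G u v)

eccMatrix : {n : ℕ} → Graph n → Fin n → Fin n → ℕ
eccMatrix G u v =
  if dist G u v ≡ᵇ (ecc G u ⊓ ecc G v) then dist G u v else 0

connected : {n : ℕ} → Graph n → Set
connected {n} G = ∀ (u v : Fin n) → reach G n u v ≡ true

-- The tree T_{n,3}^{a,b}, n = a + b + 4.
-- Labels: v0,v1,v2,v3 are 0,1,2,3; the a pendants at v1 are 4,…,3+a;
-- the b pendants at v2 are 4+a,…,3+a+b.

inRange : ℕ → ℕ → ℕ → Bool
inRange lo hi k = (lo ≤ᵇ k) ∧ (k <ᵇ hi)

treeEdge : ℕ → ℕ → ℕ → ℕ → Bool
treeEdge a b i j =
     ((i ≡ᵇ 0) ∧ (j ≡ᵇ 1))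
  ∨ ((i ≡ᵇ 1) ∧ (j ≡ᵇ 2))
  ∨ ((i ≡ᵇ 2) ∧ (j ≡ᵇ 3))
  ∨ ((i ≡ᵇ 1) ∧ inRange 4 (4 + a) j)
  ∨ ((i ≡ᵇ 2) ∧ inRange (4 + a) (4 + a + b) j)

T3 : (a b : ℕ) → Graph (a + b + 4)
T3 a b u v = treeEdge a b (toℕ u) (toℕ v) ∨ treeEdge a b (toℕ v) (toℕ u)

-- Polynomials over ℤ as coefficient lists (lowest degree first).

Poly : Set
Poly = List ℤ

_⊕_ : Poly → Poly → Poly
[] ⊕ q = q
p ⊕ [] = p
(x ∷ p) ⊕ (y ∷ q) = (x +ℤ y) ∷ (p ⊕ q)

scale : ℤ → Poly → Poly
scale c [] = []
scale c (x ∷ p) = (c *ℤ x) ∷ scale c p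

_⊗_ : Poly → Poly → Poly
[] ⊗ q = []
(x ∷ p) ⊗ q = scale x q ⊕ (+ 0 ∷ (p ⊗ q))

coeff : Poly → ℕ → ℤ
coeff []      i       = + 0
coeff (x ∷ p) zero    = x
coeff (x ∷ p) (suc i) = coeff p i

sign : ℕ → ℤ
sign zero = + 1
sign (suc zero) = - (+ 1)
sign (suc (suc k)) = sign k

det : {n : ℕ} → (Fin n → Fin n → Poly) → Poly
det {zero}  M = + 1 ∷ []
det {suc n} M = go n M
  where
  sumCols : {m : ℕ} → (Fin m → Poly) → Poly
  sumCols {zero} f = []
  sumCols {suc m} f = f zero ⊕ sumCols (λ j → f (suc j))
  go : (k : ℕ) → (Fin (suc k) → Fin (suc k) → Poly) → Poly
  go k N = sumCols (λ j → scale (sign (toℕ j))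
             (N zero j ⊗ det (λ r c → N (suc r) (punchIn j c))))

charPoly : {n : ℕ} → (Fin n → Fin n → ℤ) → Poly
charPoly A = det (λ u v → if u == v then (- A u v) ∷ + 1 ∷ [] else (- A u v) ∷ [])

-- x^{n-4} (x^4 − (4n+1) x^2 + 16(a+1)(b+1)),  n = a + b + 4:
-- the monic polynomial whose roots (with multiplicity) are the claimed
-- spectrum ±√((4n+1 ± √Δ)/2) and 0^{(n-4)}, Δ = (4n+1)^2 − 64(a+1)(b+1).

specPoly : ℕ → ℕ → Poly
specPoly a b =
  replicate (a + b) (+ 0) ++
    (+ (16 * (suc a * suc b)) ∷ + 0 ∷ - (+ (4 * (a + b + 4) + 1)) ∷ + 0 ∷ + 1 ∷ [])

-- discriminant Δ of t² − (4n+1) t + 16(a+1)(b+1)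
disc : ℕ → ℕ → ℤ
disc a b = (+ (4 * (a + b + 4) + 1)) *ℤ (+ (4 * (a + b + 4) + 1))
           Data.Integer.- (+ (64 * (suc a * suc b)))

ecc-matrix-ℤ : {n : ℕ} → Graph n → Fin n → Fin n → ℤ
ecc-matrix-ℤ G u v = + (eccMatrix G u v)

{-# OPTIONS --safe #-}
-- Label the vertices of T by their roles: the centres v₁, v₂ and the leaves at each
-- centre. In the complement of T, vertices adjacent in T are at distance 2, except the
-- centres, which are at distance 3, and all other pairs are adjacent; the centres have
-- eccentricity 3 and the leaves 2. So the nonzero entries of E are 3 at v₁v₂ and 2 at
-- each leaf and its centre: E is a weighted adjacency matrix of T itself. Expanding
-- det(xI − E) along the row of a leaf ℓ with centre c gives x·χ(−ℓ) − 4·χ(−ℓ−c), where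
-- χ(−S) is the same determinant with the vertices S deleted (just x·χ(−ℓ) if c is
-- already deleted). Peeling off leaves thus couples the four layouts with or without
-- each centre, and the recurrences are solved by x^{n−4}(x⁴ − (4n+1)x² + 16(a+1)(b+1)),
-- x^{n−3}(x² − 4(a+1)), x^{n−3}(x² − 4(b+1)) and x^{n−2}.
module Submission where

open import Defs
open import Data.Nat using (ℕ; _≤_)
open import Data.Integer using (+_; _<_)
open import Data.Product using (_×_)
open import Relation.Binary.PropositionalEquality using (_≡_)

open import Data.Bool using (Bool; true; false; _∧_; _∨_; not; if_then_else_; T)
import Data.Bool.Properties as Boolₚ
open import Data.Empty using (⊥-elim)
open import Data.Fin as Fin using (Fin; zero; suc; toℕ; fromℕ; inject₁; punchIn)
import Data.Fin.Properties as Finₚ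
import Data.Integer as ℤ
import Data.Integer.Properties as ℤₚ
import Data.Integer.Solver as ℤ-Solver
open import Data.List using (List; []; _∷_; replicate; _++_; length)
open import Data.List.Relation.Unary.All using (All; []; _∷_)
open import Data.Nat using (zero; suc; pred; _+_; _*_; _∸_; _<ᵇ_; _≡ᵇ_; _⊓_; z≤n; s≤s) renaming (_<_ to _<ℕ_)
import Data.Nat.Properties as ℕₚ
import Data.Nat.Solver as ℕ-Solver
open import Data.Product using (∃; _,_; proj₁; proj₂)
open import Data.Sum using (_⊎_; inj₁; inj₂)
open import Function using (_∘_)
open import Function.Bundles using (Equivalence)
open import Relation.Binary.Bundles using (Setoid)
import Relation.Binary.Reasoning.Setoid as SetoidReasoning
open import Relation.Binary.PropositionalEquality using (_≢_; refl; sym; trans; cong; cong₂; subst; module ≡-Reasoning)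
open import Relation.Nullary using (yes; no)

-- Polynomials up to coefficientwise equality

infix 4 _≈_
record _≈_ (p q : Poly) : Set where
  constructor mk≈
  field at : ∀ i → coeff p i ≡ coeff q i
open _≈_

≈-refl : ∀ {p} → p ≈ p
≈-refl = mk≈ λ _ → refl

≈-sym : ∀ {p q} → p ≈ q → q ≈ p
≈-sym e = mk≈ λ i → sym (at e i)

≈-trans : ∀ {p q r} → p ≈ q → q ≈ r → p ≈ r
≈-trans e f = mk≈ λ i → trans (at e i) (at f i)

≡⇒≈ : ∀ {p q} → p ≡ q → p ≈ q
≡⇒≈ refl = ≈-refl

≈-setoid : Setoid _ _
≈-setoid = record
  { Carrier = Poly ; _≈_ = _≈_
  ; isEquivalence = record { refl = ≈-refl ; sym = ≈-sym ; trans = ≈-trans } }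

module ≈-Reasoning = SetoidReasoning ≈-setoid

coeff-⊕ : ∀ p q i → coeff (p ⊕ q) i ≡ coeff p i ℤ.+ coeff q i
coeff-⊕ []      q       i       = sym (ℤₚ.+-identityˡ (coeff q i))
coeff-⊕ (x ∷ p) []      i       = sym (ℤₚ.+-identityʳ (coeff (x ∷ p) i))
coeff-⊕ (x ∷ p) (y ∷ q) zero    = refl
coeff-⊕ (x ∷ p) (y ∷ q) (suc i) = coeff-⊕ p q i

coeff-scale : ∀ c p i → coeff (scale c p) i ≡ c ℤ.* coeff p i
coeff-scale c []      i       = sym (ℤₚ.*-zeroʳ c)
coeff-scale c (x ∷ p) zero    = refl
coeff-scale c (x ∷ p) (suc i) = coeff-scale c p i

∷-cong : ∀ {x y p q} → x ≡ y → p ≈ q → x ∷ p ≈ y ∷ q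
∷-cong e f = mk≈ λ { zero → e ; (suc i) → at f i }

0∷-zero : ∀ {p} → p ≈ [] → + 0 ∷ p ≈ []
0∷-zero e = mk≈ λ { zero → refl ; (suc i) → at e i }

⊕-cong : ∀ {p p′ q q′} → p ≈ p′ → q ≈ q′ → p ⊕ q ≈ p′ ⊕ q′
⊕-cong {p} {p′} {q} {q′} e f = mk≈ λ i → begin
  coeff (p ⊕ q) i           ≡⟨ coeff-⊕ p q i ⟩
  coeff p i ℤ.+ coeff q i   ≡⟨ cong₂ ℤ._+_ (at e i) (at f i) ⟩
  coeff p′ i ℤ.+ coeff q′ i ≡⟨ coeff-⊕ p′ q′ i ⟨
  coeff (p′ ⊕ q′) i         ∎
  where open ≡-Reasoning

⊕-congˡ : ∀ p {q q′} → q ≈ q′ → p ⊕ q ≈ p ⊕ q′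
⊕-congˡ p = ⊕-cong (≈-refl {p})

⊕-congʳ : ∀ {p p′} q → p ≈ p′ → p ⊕ q ≈ p′ ⊕ q
⊕-congʳ q e = ⊕-cong e (≈-refl {q})

⊕-identityʳ : ∀ p → p ⊕ [] ≈ p
⊕-identityʳ p = mk≈ λ i → trans (coeff-⊕ p [] i) (ℤₚ.+-identityʳ (coeff p i))

⊕-comm : ∀ p q → p ⊕ q ≈ q ⊕ p
⊕-comm p q = mk≈ λ i →
  trans (coeff-⊕ p q i) (trans (ℤₚ.+-comm (coeff p i) (coeff q i)) (sym (coeff-⊕ q p i)))

⊕-assoc : ∀ p q r → (p ⊕ q) ⊕ r ≈ p ⊕ (q ⊕ r)
⊕-assoc p q r = mk≈ λ i → begin
  coeff ((p ⊕ q) ⊕ r) i                   ≡⟨ coeff-⊕ (p ⊕ q) r i ⟩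
  coeff (p ⊕ q) i ℤ.+ coeff r i           ≡⟨ cong (λ t → t ℤ.+ coeff r i) (coeff-⊕ p q i) ⟩
  (coeff p i ℤ.+ coeff q i) ℤ.+ coeff r i ≡⟨ ℤₚ.+-assoc (coeff p i) (coeff q i) (coeff r i) ⟩
  coeff p i ℤ.+ (coeff q i ℤ.+ coeff r i) ≡⟨ cong (λ t → coeff p i ℤ.+ t) (coeff-⊕ q r i) ⟨
  coeff p i ℤ.+ coeff (q ⊕ r) i           ≡⟨ coeff-⊕ p (q ⊕ r) i ⟨
  coeff (p ⊕ (q ⊕ r)) i                   ∎
  where open ≡-Reasoning

⊕-interchange : ∀ p q r s → (p ⊕ q) ⊕ (r ⊕ s) ≈ (p ⊕ r) ⊕ (q ⊕ s)
⊕-interchange p q r s = begin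
  (p ⊕ q) ⊕ (r ⊕ s) ≈⟨ ⊕-assoc p q (r ⊕ s) ⟩
  p ⊕ (q ⊕ (r ⊕ s)) ≈⟨ ⊕-congˡ p (⊕-assoc q r s) ⟨
  p ⊕ ((q ⊕ r) ⊕ s) ≈⟨ ⊕-congˡ p (⊕-congʳ s (⊕-comm q r)) ⟩
  p ⊕ ((r ⊕ q) ⊕ s) ≈⟨ ⊕-congˡ p (⊕-assoc r q s) ⟩
  p ⊕ (r ⊕ (q ⊕ s)) ≈⟨ ⊕-assoc p r (q ⊕ s) ⟨
  (p ⊕ r) ⊕ (q ⊕ s) ∎
  where open ≈-Reasoning

⊕-swapˡ : ∀ p q r → p ⊕ (q ⊕ r) ≈ q ⊕ (p ⊕ r)
⊕-swapˡ p q r =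
  ≈-trans (≈-sym (⊕-assoc p q r)) (≈-trans (⊕-congʳ r (⊕-comm p q)) (⊕-assoc q p r))

scale-cong : ∀ c {p q} → p ≈ q → scale c p ≈ scale c q
scale-cong c {p} {q} e = mk≈ λ i →
  trans (coeff-scale c p i) (trans (cong (λ t → c ℤ.* t) (at e i)) (sym (coeff-scale c q i)))

scale-congʳ : ∀ {c d} p → c ≡ d → scale c p ≈ scale d p
scale-congʳ p refl = ≈-refl

scale-by-0 : ∀ p → scale (+ 0) p ≈ []
scale-by-0 p = mk≈ (coeff-scale (+ 0) p)

scale-by-1 : ∀ p → scale (+ 1) p ≈ p
scale-by-1 p = mk≈ λ i → trans (coeff-scale (+ 1) p i) (ℤₚ.*-identityˡ (coeff p i))

scale-distribˡ-⊕ : ∀ c p q → scale c (p ⊕ q) ≈ scale c p ⊕ scale c q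
scale-distribˡ-⊕ c p q = mk≈ λ i → begin
  coeff (scale c (p ⊕ q)) i                     ≡⟨ coeff-scale c (p ⊕ q) i ⟩
  c ℤ.* coeff (p ⊕ q) i                         ≡⟨ cong (λ t → c ℤ.* t) (coeff-⊕ p q i) ⟩
  c ℤ.* (coeff p i ℤ.+ coeff q i)               ≡⟨ ℤₚ.*-distribˡ-+ c (coeff p i) (coeff q i) ⟩
  c ℤ.* coeff p i ℤ.+ c ℤ.* coeff q i           ≡⟨ cong₂ ℤ._+_ (coeff-scale c p i) (coeff-scale c q i) ⟨
  coeff (scale c p) i ℤ.+ coeff (scale c q) i   ≡⟨ coeff-⊕ (scale c p) (scale c q) i ⟨
  coeff (scale c p ⊕ scale c q) i               ∎
  where open ≡-Reasoning

scale-distribʳ-+ : ∀ c d p → scale (c ℤ.+ d) p ≈ scale c p ⊕ scale d p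
scale-distribʳ-+ c d p = mk≈ λ i → begin
  coeff (scale (c ℤ.+ d) p) i                   ≡⟨ coeff-scale (c ℤ.+ d) p i ⟩
  (c ℤ.+ d) ℤ.* coeff p i                       ≡⟨ ℤₚ.*-distribʳ-+ (coeff p i) c d ⟩
  c ℤ.* coeff p i ℤ.+ d ℤ.* coeff p i           ≡⟨ cong₂ ℤ._+_ (coeff-scale c p i) (coeff-scale d p i) ⟨
  coeff (scale c p) i ℤ.+ coeff (scale d p) i   ≡⟨ coeff-⊕ (scale c p) (scale d p) i ⟨
  coeff (scale c p ⊕ scale d p) i               ∎
  where open ≡-Reasoning

scale-assoc : ∀ c d p → scale c (scale d p) ≈ scale (c ℤ.* d) p
scale-assoc c d p = mk≈ λ i → begin
  coeff (scale c (scale d p)) i ≡⟨ coeff-scale c (scale d p) i ⟩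
  c ℤ.* coeff (scale d p) i     ≡⟨ cong (λ t → c ℤ.* t) (coeff-scale d p i) ⟩
  c ℤ.* (d ℤ.* coeff p i)       ≡⟨ ℤₚ.*-assoc c d (coeff p i) ⟨
  (c ℤ.* d) ℤ.* coeff p i       ≡⟨ coeff-scale (c ℤ.* d) p i ⟨
  coeff (scale (c ℤ.* d) p) i   ∎
  where open ≡-Reasoning

⊗-zeroˡ : ∀ {p} q → p ≈ [] → p ⊗ q ≈ []
⊗-zeroˡ {[]}    q e = ≈-refl
⊗-zeroˡ {x ∷ p} q e = 0∷-zero-⊕
  where
  0∷-zero-⊕ : scale x q ⊕ (+ 0 ∷ (p ⊗ q)) ≈ []
  0∷-zero-⊕ = ⊕-cong (≈-trans (scale-congʳ q (at e zero)) (scale-by-0 q))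
                     (0∷-zero (⊗-zeroˡ {p} q (mk≈ (at e ∘ suc))))

⊗-[]ʳ : ∀ p → p ⊗ [] ≈ []
⊗-[]ʳ []      = ≈-refl
⊗-[]ʳ (x ∷ p) = 0∷-zero (⊗-[]ʳ p)

⊗-congʳ : ∀ {p p′} q → p ≈ p′ → p ⊗ q ≈ p′ ⊗ q
⊗-congʳ {[]}    {[]}     q e = ≈-refl
⊗-congʳ {[]}    {y ∷ p′} q e = ≈-sym (⊗-zeroˡ {y ∷ p′} q (≈-sym e))
⊗-congʳ {x ∷ p} {[]}     q e = ⊗-zeroˡ {x ∷ p} q e
⊗-congʳ {x ∷ p} {y ∷ p′} q e =
  ⊕-cong (scale-congʳ q (at e zero)) (∷-cong refl (⊗-congʳ {p} {p′} q (mk≈ (at e ∘ suc))))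

⊗-congˡ : ∀ p {q q′} → q ≈ q′ → p ⊗ q ≈ p ⊗ q′
⊗-congˡ []      e = ≈-refl
⊗-congˡ (x ∷ p) e = ⊕-cong (scale-cong x e) (∷-cong refl (⊗-congˡ p e))

⊗-cong : ∀ {p p′ q q′} → p ≈ p′ → q ≈ q′ → p ⊗ q ≈ p′ ⊗ q′
⊗-cong {p} {p′} {q} e f = ≈-trans (⊗-congʳ q e) (⊗-congˡ p′ f)

⊗-zeroʳ : ∀ p {q} → q ≈ [] → p ⊗ q ≈ []
⊗-zeroʳ p e = ≈-trans (⊗-congˡ p e) (⊗-[]ʳ p)

⊗-distribʳ-⊕ : ∀ p p′ q → (p ⊕ p′) ⊗ q ≈ (p ⊗ q) ⊕ (p′ ⊗ q)
⊗-distribʳ-⊕ []      p′       q = ≈-refl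
⊗-distribʳ-⊕ (x ∷ p) []       q = ≈-sym (⊕-identityʳ ((x ∷ p) ⊗ q))
⊗-distribʳ-⊕ (x ∷ p) (y ∷ p′) q = begin
  scale (x ℤ.+ y) q ⊕ (+ 0 ∷ ((p ⊕ p′) ⊗ q))
    ≈⟨ ⊕-cong (scale-distribʳ-+ x y q) (∷-cong refl (⊗-distribʳ-⊕ p p′ q)) ⟩
  (scale x q ⊕ scale y q) ⊕ ((+ 0 ∷ (p ⊗ q)) ⊕ (+ 0 ∷ (p′ ⊗ q)))
    ≈⟨ ⊕-interchange (scale x q) (scale y q) _ _ ⟩
  (scale x q ⊕ (+ 0 ∷ (p ⊗ q))) ⊕ (scale y q ⊕ (+ 0 ∷ (p′ ⊗ q))) ∎
  where open ≈-Reasoning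

⊗-distribˡ-⊕ : ∀ p q q′ → p ⊗ (q ⊕ q′) ≈ (p ⊗ q) ⊕ (p ⊗ q′)
⊗-distribˡ-⊕ []      q q′ = ≈-refl
⊗-distribˡ-⊕ (x ∷ p) q q′ = begin
  scale x (q ⊕ q′) ⊕ (+ 0 ∷ (p ⊗ (q ⊕ q′)))
    ≈⟨ ⊕-cong (scale-distribˡ-⊕ x q q′) (∷-cong refl (⊗-distribˡ-⊕ p q q′)) ⟩
  (scale x q ⊕ scale x q′) ⊕ ((+ 0 ∷ (p ⊗ q)) ⊕ (+ 0 ∷ (p ⊗ q′)))
    ≈⟨ ⊕-interchange (scale x q) (scale x q′) _ _ ⟩
  (scale x q ⊕ (+ 0 ∷ (p ⊗ q))) ⊕ (scale x q′ ⊕ (+ 0 ∷ (p ⊗ q′))) ∎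
  where open ≈-Reasoning

scale-⊗ˡ : ∀ c p q → scale c (p ⊗ q) ≈ scale c p ⊗ q
scale-⊗ˡ c []      q = ≈-refl
scale-⊗ˡ c (x ∷ p) q = begin
  scale c (scale x q ⊕ (+ 0 ∷ (p ⊗ q)))
    ≈⟨ scale-distribˡ-⊕ c (scale x q) _ ⟩
  scale c (scale x q) ⊕ ((c ℤ.* + 0) ∷ scale c (p ⊗ q))
    ≈⟨ ⊕-cong (scale-assoc c x q) (∷-cong (ℤₚ.*-zeroʳ c) (scale-⊗ˡ c p q)) ⟩
  scale (c ℤ.* x) q ⊕ (+ 0 ∷ (scale c p ⊗ q)) ∎
  where open ≈-Reasoning

scale-⊗ʳ : ∀ c p q → scale c (p ⊗ q) ≈ p ⊗ scale c q
scale-⊗ʳ c []      q = ≈-refl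
scale-⊗ʳ c (x ∷ p) q = begin
  scale c (scale x q ⊕ (+ 0 ∷ (p ⊗ q)))
    ≈⟨ scale-distribˡ-⊕ c (scale x q) _ ⟩
  scale c (scale x q) ⊕ ((c ℤ.* + 0) ∷ scale c (p ⊗ q))
    ≈⟨ ⊕-cong scale-comm (∷-cong (ℤₚ.*-zeroʳ c) (scale-⊗ʳ c p q)) ⟩
  scale x (scale c q) ⊕ (+ 0 ∷ (p ⊗ scale c q)) ∎
  where
  open ≈-Reasoning
  scale-comm : scale c (scale x q) ≈ scale x (scale c q)
  scale-comm = ≈-trans (scale-assoc c x q)
    (≈-trans (scale-congʳ q (ℤₚ.*-comm c x)) (≈-sym (scale-assoc x c q)))

0∷-⊗ˡ : ∀ p q → (+ 0 ∷ p) ⊗ q ≈ + 0 ∷ (p ⊗ q)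
0∷-⊗ˡ p q = ⊕-congʳ (+ 0 ∷ (p ⊗ q)) (scale-by-0 q)

0∷-⊗ʳ : ∀ p q → p ⊗ (+ 0 ∷ q) ≈ + 0 ∷ (p ⊗ q)
0∷-⊗ʳ []      q = ≈-sym (0∷-zero ≈-refl)
0∷-⊗ʳ (x ∷ p) q =
  ⊕-cong (∷-cong (ℤₚ.*-zeroʳ x) (≈-refl {scale x q})) (∷-cong refl (0∷-⊗ʳ p q))

⊗-constʳ : ∀ p x → p ⊗ (x ∷ []) ≈ scale x p
⊗-constʳ []      x = ≈-refl
⊗-constʳ (y ∷ p) x =
  ∷-cong (trans (ℤₚ.+-identityʳ (y ℤ.* x)) (ℤₚ.*-comm y x)) (⊗-constʳ p x)

⊗-identityˡ : ∀ q → (+ 1 ∷ []) ⊗ q ≈ q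
⊗-identityˡ q = ≈-trans (⊕-cong (scale-by-1 q) (0∷-zero ≈-refl)) (⊕-identityʳ q)

⊗-comm : ∀ p q → p ⊗ q ≈ q ⊗ p
⊗-comm []      q = ≈-sym (⊗-[]ʳ q)
⊗-comm (x ∷ p) q = begin
  scale x q ⊕ (+ 0 ∷ (p ⊗ q))        ≈⟨ ⊕-cong (≈-sym (⊗-constʳ q x)) (∷-cong refl (⊗-comm p q)) ⟩
  (q ⊗ (x ∷ [])) ⊕ (+ 0 ∷ (q ⊗ p))   ≈⟨ ⊕-congˡ (q ⊗ (x ∷ [])) (≈-sym (0∷-⊗ʳ q p)) ⟩
  (q ⊗ (x ∷ [])) ⊕ (q ⊗ (+ 0 ∷ p))   ≈⟨ ⊗-distribˡ-⊕ q (x ∷ []) (+ 0 ∷ p) ⟨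
  q ⊗ ((x ∷ []) ⊕ (+ 0 ∷ p))         ≈⟨ ⊗-congˡ q (∷-cong (ℤₚ.+-identityʳ x) ≈-refl) ⟩
  q ⊗ (x ∷ p)                        ∎
  where open ≈-Reasoning

⊗-assoc : ∀ p q r → (p ⊗ q) ⊗ r ≈ p ⊗ (q ⊗ r)
⊗-assoc []      q r = ≈-refl
⊗-assoc (x ∷ p) q r = begin
  (scale x q ⊕ (+ 0 ∷ (p ⊗ q))) ⊗ r       ≈⟨ ⊗-distribʳ-⊕ (scale x q) _ r ⟩
  (scale x q ⊗ r) ⊕ ((+ 0 ∷ (p ⊗ q)) ⊗ r) ≈⟨ ⊕-cong (≈-sym (scale-⊗ˡ x q r)) (0∷-⊗ˡ (p ⊗ q) r) ⟩
  scale x (q ⊗ r) ⊕ (+ 0 ∷ ((p ⊗ q) ⊗ r)) ≈⟨ ⊕-congˡ (scale x (q ⊗ r)) (∷-cong refl (⊗-assoc p q r)) ⟩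
  scale x (q ⊗ r) ⊕ (+ 0 ∷ (p ⊗ (q ⊗ r))) ∎
  where open ≈-Reasoning

⊗-swapˡ : ∀ p q r → p ⊗ (q ⊗ r) ≈ q ⊗ (p ⊗ r)
⊗-swapˡ p q r = ≈-trans (≈-sym (⊗-assoc p q r))
  (≈-trans (⊗-congʳ r (⊗-comm p q)) (⊗-assoc q p r))

scale-⊗-exchange : ∀ s₁ s₂ s₃ s₄ p q r r′ → s₁ ℤ.* s₂ ≡ s₃ ℤ.* s₄ → r ≈ r′ →
  scale s₁ (p ⊗ scale s₂ (q ⊗ r)) ≈ scale s₃ (q ⊗ scale s₄ (p ⊗ r′))
scale-⊗-exchange s₁ s₂ s₃ s₄ p q r r′ s≡ r≈ = begin
  scale s₁ (p ⊗ scale s₂ (q ⊗ r))   ≈⟨ scale-cong s₁ (≈-sym (scale-⊗ʳ s₂ p (q ⊗ r))) ⟩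
  scale s₁ (scale s₂ (p ⊗ (q ⊗ r))) ≈⟨ scale-assoc s₁ s₂ _ ⟩
  scale (s₁ ℤ.* s₂) (p ⊗ (q ⊗ r))   ≈⟨ scale-congʳ _ s≡ ⟩
  scale (s₃ ℤ.* s₄) (p ⊗ (q ⊗ r))   ≈⟨ scale-cong _ (≈-trans (⊗-swapˡ p q r) (⊗-congˡ q (⊗-congˡ p r≈))) ⟩
  scale (s₃ ℤ.* s₄) (q ⊗ (p ⊗ r′))  ≈⟨ scale-assoc s₃ s₄ _ ⟨
  scale s₃ (scale s₄ (q ⊗ (p ⊗ r′))) ≈⟨ scale-cong s₃ (scale-⊗ʳ s₄ q (p ⊗ r′)) ⟩
  scale s₃ (q ⊗ scale s₄ (p ⊗ r′))  ∎
  where open ≈-Reasoning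

-- Determinants

Mat : ℕ → Set
Mat n = Fin n → Fin n → Poly

∑ : ∀ {m} → (Fin m → Poly) → Poly
∑ {zero}  f = []
∑ {suc m} f = f zero ⊕ ∑ (λ j → f (suc j))

minor : ∀ {n} → Fin (suc n) → Fin (suc n) → Mat (suc n) → Mat n
minor r c M p q = M (punchIn r p) (punchIn c q)

laplaceTerm : ∀ {n} → Mat (suc n) → Fin (suc n) → Poly
laplaceTerm M j = scale (sign (toℕ j)) (M zero j ⊗ det (minor zero j M))

-- `det` adds up its Laplace terms with a summation function local to Defs,
-- which cannot be named here. So the statement of `local∑≡∑`, "the local sum
-- of f equals ∑ f", is left to unification: it is solved at the use in
-- `det-laplace-ones`, where `with` makes the summand a variable.
mutual
  local∑≡∑ : (m : ℕ) (f : Fin m → Poly) → _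
  local∑≡∑ zero    f = refl
  local∑≡∑ (suc m) f = cong (f zero ⊕_) (local∑≡∑ m (λ j → f (suc j)))

  det-laplace-ones : ∀ n →
    det {suc n} (λ _ _ → + 1 ∷ []) ≡ ∑ (laplaceTerm {n} (λ _ _ → + 1 ∷ []))
  det-laplace-ones n with (λ (j : Fin n) → laplaceTerm {n} (λ _ _ → + 1 ∷ []) (suc j))
  ... | g = cong (laplaceTerm {n} (λ _ _ → + 1 ∷ []) zero ⊕_) (local∑≡∑ n g)

det-laplace : ∀ n (M : Mat (suc n)) → det M ≡ ∑ (laplaceTerm M)
det-laplace n M = local∑≡∑ (suc n) (laplaceTerm M)

∑-cong : ∀ {m} {f g : Fin m → Poly} → (∀ j → f j ≈ g j) → ∑ f ≈ ∑ g
∑-cong {zero}  e = ≈-refl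
∑-cong {suc m} e = ⊕-cong (e zero) (∑-cong (e ∘ suc))

∑-zero : ∀ {m} {f : Fin m → Poly} → (∀ j → f j ≈ []) → ∑ f ≈ []
∑-zero {zero}  e = ≈-refl
∑-zero {suc m} e = ⊕-cong (e zero) (∑-zero (e ∘ suc))

∑-⊕ : ∀ {m} (f g : Fin m → Poly) → ∑ (λ j → f j ⊕ g j) ≈ ∑ f ⊕ ∑ g
∑-⊕ {zero}  f g = ≈-refl
∑-⊕ {suc m} f g = ≈-trans (⊕-congˡ (f zero ⊕ g zero) (∑-⊕ (f ∘ suc) (g ∘ suc)))
                          (⊕-interchange (f zero) (g zero) _ _)

∑-scale : ∀ {m} c (f : Fin m → Poly) → ∑ (λ j → scale c (f j)) ≈ scale c (∑ f)
∑-scale {zero}  c f = ≈-refl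
∑-scale {suc m} c f = ≈-trans (⊕-congˡ (scale c (f zero)) (∑-scale c (f ∘ suc)))
                              (≈-sym (scale-distribˡ-⊕ c (f zero) _))

∑-⊗ : ∀ {m} p (f : Fin m → Poly) → ∑ (λ j → p ⊗ f j) ≈ p ⊗ ∑ f
∑-⊗ {zero}  p f = ≈-sym (⊗-[]ʳ p)
∑-⊗ {suc m} p f = ≈-trans (⊕-congˡ (p ⊗ f zero) (∑-⊗ p (f ∘ suc)))
                          (≈-sym (⊗-distribˡ-⊕ p (f zero) _))

∑-punchIn : ∀ {m} (f : Fin (suc m) → Poly) c → ∑ f ≈ f c ⊕ ∑ (f ∘ punchIn c)
∑-punchIn f zero = ≈-refl
∑-punchIn {suc m} f (suc c) =
  ≈-trans (⊕-congˡ (f zero) (∑-punchIn (f ∘ suc) c)) (⊕-swapˡ (f zero) (f (suc c)) _)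

det-cong : ∀ {n} {M M′ : Mat n} → (∀ r c → M r c ≈ M′ r c) → det M ≈ det M′
det-cong {zero} e = ≈-refl
det-cong {suc n} {M} {M′} e = begin
  det M                ≡⟨ det-laplace n M ⟩
  ∑ (laplaceTerm M)    ≈⟨ ∑-cong (λ j → scale-cong (sign (toℕ j))
                            (⊗-cong (e zero j) (det-cong λ r c → e (suc r) (punchIn j c)))) ⟩
  ∑ (laplaceTerm M′)   ≡⟨ det-laplace n M′ ⟨
  det M′               ∎
  where open ≈-Reasoning

det-≡ : ∀ {n} {M M′ : Mat n} → (∀ r c → M r c ≡ M′ r c) → det M ≈ det M′
det-≡ e = det-cong λ r c → ≡⇒≈ (e r c)

det₁ : (M : Mat 1) → det M ≈ M zero zero ⊗ (+ 1 ∷ [])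
det₁ M = ≈-trans (≡⇒≈ (det-laplace 0 M)) (≈-trans (⊕-identityʳ _) (scale-by-1 _))

laplaceTerm-zero-entry : ∀ {n} (M : Mat (suc n)) j → M zero j ≈ [] → laplaceTerm M j ≈ []
laplaceTerm-zero-entry M j e = scale-cong (sign (toℕ j)) (⊗-zeroˡ _ e)

laplaceTerm-zero-minor : ∀ {n} (M : Mat (suc n)) j →
  det (minor zero j M) ≈ [] → laplaceTerm M j ≈ []
laplaceTerm-zero-minor M j e = scale-cong (sign (toℕ j)) (⊗-zeroʳ (M zero j) e)

sign-suc : ∀ a → sign (suc a) ≡ ℤ.- sign a
sign-suc zero          = refl
sign-suc (suc zero)    = refl
sign-suc (suc (suc a)) = sign-suc a

sign-+ : ∀ a b → sign (a + b) ≡ sign a ℤ.* sign b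
sign-+ zero          b = sym (ℤₚ.*-identityˡ (sign b))
sign-+ (suc zero)    b = trans (sign-suc b) (sym (ℤₚ.-1*i≡-i (sign b)))
sign-+ (suc (suc a)) b = sign-+ a b

sign-*-self : ∀ a → sign a ℤ.* sign a ≡ + 1
sign-*-self zero          = refl
sign-*-self (suc zero)    = refl
sign-*-self (suc (suc a)) = sign-*-self a

sign-+-self : ∀ a → sign (a + a) ≡ + 1
sign-+-self a = trans (sign-+ a a) (sign-*-self a)

sign-+-suc : ∀ a b → sign (suc a + suc b) ≡ sign (a + b)
sign-+-suc a b = cong (sign ∘ suc) (ℕₚ.+-suc a b)

sign[1+a+b]*sign[b+a]≡-1 : ∀ a b → sign (suc a + b) ℤ.* sign (b + a) ≡ ℤ.- + 1
sign[1+a+b]*sign[b+a]≡-1 a b = begin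
  sign (suc (a + b)) ℤ.* sign (b + a)         ≡⟨ cong₂ (λ s t → s ℤ.* sign t) (sign-suc (a + b)) (ℕₚ.+-comm b a) ⟩
  ℤ.- sign (a + b) ℤ.* sign (a + b)           ≡⟨ ℤₚ.neg-distribˡ-* (sign (a + b)) (sign (a + b)) ⟨
  ℤ.- (sign (a + b) ℤ.* sign (a + b))         ≡⟨ cong ℤ.-_ (sign-*-self (a + b)) ⟩
  ℤ.- + 1                                     ∎
  where open ≡-Reasoning

punchIn-fromℕ : ∀ {n} (j : Fin n) → punchIn (fromℕ n) j ≡ inject₁ j
punchIn-fromℕ {suc n} zero    = refl
punchIn-fromℕ {suc n} (suc j) = cong suc (punchIn-fromℕ j)

punchIn-inject₁-fromℕ : ∀ {n} (j : Fin (suc n)) → punchIn (inject₁ j) (fromℕ n) ≡ fromℕ (suc n)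
punchIn-inject₁-fromℕ zero            = refl
punchIn-inject₁-fromℕ {suc n} (suc j) = cong suc (punchIn-inject₁-fromℕ j)

punchIn-inject₁ : ∀ {n} (j : Fin (suc n)) (q : Fin n) →
  punchIn (inject₁ j) (inject₁ q) ≡ inject₁ (punchIn j q)
punchIn-inject₁ zero    q       = refl
punchIn-inject₁ (suc j) zero    = refl
punchIn-inject₁ (suc j) (suc q) = cong suc (punchIn-inject₁ j q)

punchIn-fromℕ-fromℕ : ∀ {n} (j : Fin (suc n)) →
  punchIn (punchIn (fromℕ (suc n)) j) (fromℕ n) ≡ fromℕ (suc n)
punchIn-fromℕ-fromℕ {n} j = trans (cong (λ i → punchIn i (fromℕ n)) (punchIn-fromℕ j))
                                  (punchIn-inject₁-fromℕ j)

punchIn-fromℕ-punchIn : ∀ {n} (j : Fin (suc n)) (q : Fin n) →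
  punchIn (punchIn (fromℕ (suc n)) j) (punchIn (fromℕ n) q) ≡ punchIn (fromℕ (suc n)) (punchIn j q)
punchIn-fromℕ-punchIn j q = trans (cong₂ punchIn (punchIn-fromℕ j) (punchIn-fromℕ q))
  (trans (punchIn-inject₁ j q) (sym (punchIn-fromℕ (punchIn j q))))

toℕ-punchIn-fromℕ : ∀ {n} (j : Fin n) → toℕ (punchIn (fromℕ n) j) ≡ toℕ j
toℕ-punchIn-fromℕ j = trans (cong toℕ (punchIn-fromℕ j)) (Finₚ.toℕ-inject₁ j)

-- Deleting column `punchIn c j` moves column c to position `relocate c j`.
relocate : ∀ {m} → Fin (suc (suc m)) → Fin (suc m) → Fin (suc m)
relocate zero    j               = zero
relocate (suc c) zero            = c
relocate {suc m} (suc c) (suc j) = suc (relocate c j)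

punchIn-relocate : ∀ {m} (c : Fin (suc (suc m))) j → punchIn (punchIn c j) (relocate c j) ≡ c
punchIn-relocate zero    j               = refl
punchIn-relocate (suc c) zero            = refl
punchIn-relocate {suc m} (suc c) (suc j) = cong suc (punchIn-relocate c j)

punchIn-relocate-punchIn : ∀ {m} (c : Fin (suc (suc m))) j (q : Fin m) →
  punchIn (punchIn c j) (punchIn (relocate c j) q) ≡ punchIn c (punchIn j q)
punchIn-relocate-punchIn zero    j               q       = refl
punchIn-relocate-punchIn (suc c) zero            q       = refl
punchIn-relocate-punchIn {suc m} (suc c) (suc j) zero    = refl
punchIn-relocate-punchIn {suc m} (suc c) (suc j) (suc q) = cong suc (punchIn-relocate-punchIn c j q)

sign-relocate : ∀ {m} (c : Fin (suc (suc m))) j →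
  sign (toℕ (punchIn c j) + toℕ (relocate c j)) ≡ ℤ.- sign (toℕ c + toℕ j)
sign-relocate zero    j = trans (cong sign (ℕₚ.+-identityʳ (suc (toℕ j)))) (sign-suc (toℕ j))
sign-relocate (suc c) zero = trans (sym (ℤₚ.neg-involutive (sign (toℕ c))))
  (cong ℤ.-_ (sym (trans (cong sign (ℕₚ.+-identityʳ (suc (toℕ c)))) (sign-suc (toℕ c)))))
sign-relocate {suc m} (suc c) (suc j) = trans (sign-+-suc (toℕ (punchIn c j)) (toℕ (relocate c j)))
  (trans (sign-relocate c j) (cong ℤ.-_ (sym (sign-+-suc (toℕ c) (toℕ j)))))

-- The two orders of expanding along the first and the last row give the same sign.
sign-relocate-exchange : ∀ n (c : Fin (suc (suc n))) j →
  sign (toℕ (punchIn c j)) ℤ.* sign (n + toℕ (relocate c j)) ≡ sign (suc n + toℕ c) ℤ.* sign (toℕ j)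
sign-relocate-exchange n c j′ = begin
  sign j ℤ.* sign (n + k)                 ≡⟨ cong (sign j ℤ.*_) (sign-+ n k) ⟩
  sign j ℤ.* (sign n ℤ.* sign k)          ≡⟨ solve 3 (λ x y z → x :* (y :* z) := y :* (x :* z))
                                                   refl (sign j) (sign n) (sign k) ⟩
  sign n ℤ.* (sign j ℤ.* sign k)          ≡⟨ cong (sign n ℤ.*_) (sym (sign-+ j k)) ⟩
  sign n ℤ.* sign (j + k)                 ≡⟨ cong (sign n ℤ.*_) (sign-relocate c j′) ⟩
  sign n ℤ.* ℤ.- sign (toℕ c + toℕ j′)    ≡⟨ cong (λ t → sign n ℤ.* ℤ.- t) (sign-+ (toℕ c) (toℕ j′)) ⟩
  sign n ℤ.* ℤ.- (sign (toℕ c) ℤ.* sign (toℕ j′))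
    ≡⟨ solve 3 (λ x y z → x :* (:- (y :* z)) := (:- (x :* y)) :* z)
               refl (sign n) (sign (toℕ c)) (sign (toℕ j′)) ⟩
  ℤ.- (sign n ℤ.* sign (toℕ c)) ℤ.* sign (toℕ j′)
    ≡⟨ cong (λ t → ℤ.- t ℤ.* sign (toℕ j′)) (sym (sign-+ n (toℕ c))) ⟩
  ℤ.- sign (n + toℕ c) ℤ.* sign (toℕ j′) ≡⟨ cong (ℤ._* sign (toℕ j′)) (sym (sign-suc (n + toℕ c))) ⟩
  sign (suc n + toℕ c) ℤ.* sign (toℕ j′) ∎
  where
  open ≡-Reasoning
  open ℤ-Solver.+-*-Solver
  j = toℕ (punchIn c j′)
  k = toℕ (relocate c j′)

det-lastRow-zero : ∀ n (M : Mat (suc n)) → (∀ j → M (fromℕ n) j ≈ []) → det M ≈ []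
det-lastRow-zero zero    M e = ≈-trans (det₁ M) (⊗-zeroˡ _ (e zero))
det-lastRow-zero (suc n) M e = ≈-trans (≡⇒≈ (det-laplace (suc n) M)) (∑-zero λ j →
  laplaceTerm-zero-minor M j (det-lastRow-zero n (minor zero j M) (e ∘ punchIn j)))

laplaceTerm-lastCol-zero : ∀ n (M : Mat (suc (suc n))) → (∀ r → M (suc r) (fromℕ (suc n)) ≈ []) →
  ∑ (laplaceTerm M ∘ punchIn (fromℕ (suc n))) ≈ []
laplaceTerm-lastCol-zero n M e = ∑-zero λ j → laplaceTerm-zero-minor M (punchIn (fromℕ (suc n)) j)
  (det-lastCol-zero n (minor zero (punchIn (fromℕ (suc n)) j) M) λ r → ≈-trans (≡⇒≈ (cong (M (suc r)) (punchIn-fromℕ-fromℕ j))) (e r))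
  where
  det-lastCol-zero : ∀ n (M : Mat (suc n)) → (∀ r → M r (fromℕ n) ≈ []) → det M ≈ []
  det-lastCol-zero zero    M e = ≈-trans (det₁ M) (⊗-zeroˡ _ (e zero))
  det-lastCol-zero (suc n) M e = ≈-trans (≡⇒≈ (det-laplace (suc n) M))
    (≈-trans (∑-punchIn (laplaceTerm M) (fromℕ (suc n)))
      (⊕-cong (laplaceTerm-zero-entry M (fromℕ (suc n)) (e zero))
              (laplaceTerm-lastCol-zero n M (e ∘ suc))))

det-lastRow-single : ∀ n (M : Mat (suc n)) c → (∀ j → j ≢ c → M (fromℕ n) j ≈ []) →
  det M ≈ scale (sign (n + toℕ c)) (M (fromℕ n) c ⊗ det (minor (fromℕ n) c M))
det-lastRow-single zero    M zero e = ≈-trans (≡⇒≈ (det-laplace 0 M)) (⊕-identityʳ _)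
det-lastRow-single (suc n) M c    e = begin
  det M                                       ≡⟨ det-laplace (suc n) M ⟩
  ∑ (laplaceTerm M)                           ≈⟨ ∑-punchIn (laplaceTerm M) c ⟩
  laplaceTerm M c ⊕ ∑ (laplaceTerm M ∘ punchIn c)
    ≈⟨ ⊕-cong (laplaceTerm-zero-minor M c (det-lastRow-zero n (minor zero c M) λ q → e (punchIn c q) (Finₚ.punchInᵢ≢i c q)))
              (∑-cong other) ⟩
  ∑ (λ j → scale s (B ⊗ laplaceTerm N j))     ≈⟨ ∑-scale s (λ j → B ⊗ laplaceTerm N j) ⟩
  scale s (∑ (λ j → B ⊗ laplaceTerm N j))     ≈⟨ scale-cong s (∑-⊗ B (laplaceTerm N)) ⟩
  scale s (B ⊗ ∑ (laplaceTerm N))             ≡⟨ cong (λ d → scale s (B ⊗ d)) (det-laplace n N) ⟨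
  scale s (B ⊗ det N)                         ∎
  where
  open ≈-Reasoning
  ℓ = fromℕ (suc n)
  s = sign (suc n + toℕ c)
  B = M ℓ c
  N = minor ℓ c M
  other : ∀ j → laplaceTerm M (punchIn c j) ≈ scale s (B ⊗ laplaceTerm N j)
  other j = ≈-trans (scale-cong _ (⊗-congˡ (M zero (punchIn c j)) minor-expansion))
    (scale-⊗-exchange (sign (toℕ (punchIn c j))) (sign (n + toℕ k)) s (sign (toℕ j))
      (M zero (punchIn c j)) B _ _ (sign-relocate-exchange n c j)
      (det-≡ λ p q → cong (M (suc (punchIn (fromℕ n) p))) (punchIn-relocate-punchIn c j q)))
    where
    k = relocate c j
    minor-expansion : det (minor zero (punchIn c j) M)
      ≈ scale (sign (n + toℕ k)) (B ⊗ det (minor (fromℕ n) k (minor zero (punchIn c j) M)))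
    minor-expansion = ≈-trans
      (det-lastRow-single n (minor zero (punchIn c j) M) k λ q q≢k → e (punchIn (punchIn c j) q)
        (q≢k ∘ Finₚ.punchIn-injective (punchIn c j) q k ∘ λ eq → trans eq (sym (punchIn-relocate c j))))
      (scale-cong _ (⊗-congʳ _ (≡⇒≈ (cong (M ℓ) (punchIn-relocate c j)))))

det-lastCol-single : ∀ n (M : Mat (suc n)) u → (∀ r → r ≢ u → M r (fromℕ n) ≈ []) →
  det M ≈ scale (sign (toℕ u + n)) (M u (fromℕ n) ⊗ det (minor u (fromℕ n) M))
det-lastCol-single zero    M zero e = ≈-trans (≡⇒≈ (det-laplace 0 M)) (⊕-identityʳ _)
det-lastCol-single (suc n) M zero e = begin
  det M                                                     ≡⟨ det-laplace (suc n) M ⟩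
  ∑ (laplaceTerm M)                                         ≈⟨ ∑-punchIn (laplaceTerm M) ℓ ⟩
  laplaceTerm M ℓ ⊕ ∑ (laplaceTerm M ∘ punchIn ℓ)           ≈⟨ ⊕-congˡ (laplaceTerm M ℓ) (laplaceTerm-lastCol-zero n M λ r → e (suc r) λ ()) ⟩
  laplaceTerm M ℓ ⊕ []                                      ≈⟨ ⊕-identityʳ (laplaceTerm M ℓ) ⟩
  laplaceTerm M ℓ                                           ≈⟨ scale-congʳ _ (cong sign (Finₚ.toℕ-fromℕ (suc n))) ⟩
  scale (sign (suc n)) (M zero ℓ ⊗ det (minor zero ℓ M))    ∎
  where
  open ≈-Reasoning
  ℓ = fromℕ (suc n)
det-lastCol-single (suc n) M (suc u) e = begin
  det M                                       ≡⟨ det-laplace (suc n) M ⟩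
  ∑ (laplaceTerm M)                           ≈⟨ ∑-punchIn (laplaceTerm M) ℓ ⟩
  laplaceTerm M ℓ ⊕ ∑ (laplaceTerm M ∘ punchIn ℓ)
    ≈⟨ ⊕-cong (laplaceTerm-zero-entry M ℓ (e zero λ ())) (∑-cong other) ⟩
  ∑ (λ j → scale s (B ⊗ laplaceTerm N j))     ≈⟨ ∑-scale s (λ j → B ⊗ laplaceTerm N j) ⟩
  scale s (∑ (λ j → B ⊗ laplaceTerm N j))     ≈⟨ scale-cong s (∑-⊗ B (laplaceTerm N)) ⟩
  scale s (B ⊗ ∑ (laplaceTerm N))             ≡⟨ cong (λ d → scale s (B ⊗ d)) (det-laplace n N) ⟨
  scale s (B ⊗ det N)                         ∎
  where
  open ≈-Reasoning
  ℓ = fromℕ (suc n)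
  s = sign (suc (toℕ u) + suc n)
  B = M (suc u) ℓ
  N = minor (suc u) ℓ M
  other : ∀ j → laplaceTerm M (punchIn ℓ j) ≈ scale s (B ⊗ laplaceTerm N j)
  other j = ≈-trans (scale-cong _ (⊗-congˡ (M zero (punchIn ℓ j)) minor-expansion))
    (scale-⊗-exchange (sign (toℕ (punchIn ℓ j))) (sign (toℕ u + n)) s (sign (toℕ j))
      (M zero (punchIn ℓ j)) B _ _ signs
      (det-≡ λ p q → cong (M (suc (punchIn u p))) (punchIn-fromℕ-punchIn j q)))
    where
    minor-expansion : det (minor zero (punchIn ℓ j) M)
      ≈ scale (sign (toℕ u + n)) (B ⊗ det (minor u (fromℕ n) (minor zero (punchIn ℓ j) M)))
    minor-expansion = ≈-trans
      (det-lastCol-single n (minor zero (punchIn ℓ j) M) u λ r r≢u →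
        ≈-trans (≡⇒≈ (cong (M (suc r)) (punchIn-fromℕ-fromℕ j))) (e (suc r) (r≢u ∘ Finₚ.suc-injective)))
      (scale-cong _ (⊗-congʳ _ (≡⇒≈ (cong (M (suc u)) (punchIn-fromℕ-fromℕ j)))))
    signs : sign (toℕ (punchIn ℓ j)) ℤ.* sign (toℕ u + n) ≡ s ℤ.* sign (toℕ j)
    signs = trans (cong (λ t → sign t ℤ.* sign (toℕ u + n)) (toℕ-punchIn-fromℕ j))
      (trans (ℤₚ.*-comm (sign (toℕ j)) (sign (toℕ u + n)))
             (cong (ℤ._* sign (toℕ j)) (sym (sign-+-suc (toℕ u) n))))

det-lastRow-additive : ∀ n (M A B : Mat (suc n)) →
  (∀ (r : Fin n) c → M (inject₁ r) c ≈ A (inject₁ r) c) →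
  (∀ (r : Fin n) c → M (inject₁ r) c ≈ B (inject₁ r) c) →
  (∀ c → M (fromℕ n) c ≈ A (fromℕ n) c ⊕ B (fromℕ n) c) →
  det M ≈ det A ⊕ det B
det-lastRow-additive zero M A B eA eB eL = begin
  det M                                                 ≈⟨ det₁ M ⟩
  M zero zero ⊗ (+ 1 ∷ [])                              ≈⟨ ⊗-congʳ (+ 1 ∷ []) (eL zero) ⟩
  (A zero zero ⊕ B zero zero) ⊗ (+ 1 ∷ [])              ≈⟨ ⊗-distribʳ-⊕ (A zero zero) (B zero zero) _ ⟩
  (A zero zero ⊗ (+ 1 ∷ [])) ⊕ (B zero zero ⊗ (+ 1 ∷ [])) ≈⟨ ⊕-cong (det₁ A) (det₁ B) ⟨
  det A ⊕ det B                                         ∎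
  where open ≈-Reasoning
det-lastRow-additive (suc n) M A B eA eB eL = begin
  det M                                        ≡⟨ det-laplace (suc n) M ⟩
  ∑ (laplaceTerm M)                            ≈⟨ ∑-cong term-additive ⟩
  ∑ (λ j → laplaceTerm A j ⊕ laplaceTerm B j)  ≈⟨ ∑-⊕ (laplaceTerm A) (laplaceTerm B) ⟩
  ∑ (laplaceTerm A) ⊕ ∑ (laplaceTerm B)        ≡⟨ cong₂ _⊕_ (det-laplace (suc n) A) (det-laplace (suc n) B) ⟨
  det A ⊕ det B                                ∎
  where
  open ≈-Reasoning
  term-additive : ∀ j → laplaceTerm M j ≈ laplaceTerm A j ⊕ laplaceTerm B j
  term-additive j = ≈-trans (scale-cong s (begin
      M zero j ⊗ det (minor zero j M)
        ≈⟨ ⊗-congˡ (M zero j) minors-additive ⟩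
      M zero j ⊗ (det (minor zero j A) ⊕ det (minor zero j B))
        ≈⟨ ⊗-distribˡ-⊕ (M zero j) _ _ ⟩
      (M zero j ⊗ det (minor zero j A)) ⊕ (M zero j ⊗ det (minor zero j B))
        ≈⟨ ⊕-cong (⊗-congʳ _ (eA zero j)) (⊗-congʳ _ (eB zero j)) ⟩
      (A zero j ⊗ det (minor zero j A)) ⊕ (B zero j ⊗ det (minor zero j B)) ∎))
    (scale-distribˡ-⊕ s (A zero j ⊗ det (minor zero j A)) (B zero j ⊗ det (minor zero j B)))
    where
    s = sign (toℕ j)
    minors-additive : det (minor zero j M) ≈ det (minor zero j A) ⊕ det (minor zero j B)
    minors-additive = det-lastRow-additive n (minor zero j M) (minor zero j A) (minor zero j B)
      (λ r c → eA (suc r) (punchIn j c)) (λ r c → eB (suc r) (punchIn j c)) (eL ∘ punchIn j)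

det-lastRow-diagonal : ∀ k (M : Mat (suc k)) → (∀ j → j ≢ fromℕ k → M (fromℕ k) j ≈ []) →
  det M ≈ M (fromℕ k) (fromℕ k) ⊗ det (λ p q → M (inject₁ p) (inject₁ q))
det-lastRow-diagonal k M e = begin
  det M
    ≈⟨ det-lastRow-single k M (fromℕ k) e ⟩
  scale (sign (k + toℕ (fromℕ k))) (M (fromℕ k) (fromℕ k) ⊗ det (minor (fromℕ k) (fromℕ k) M))
    ≈⟨ scale-congʳ _ (trans (cong (λ t → sign (k + t)) (Finₚ.toℕ-fromℕ k)) (sign-+-self k)) ⟩
  scale (+ 1) (M (fromℕ k) (fromℕ k) ⊗ det (minor (fromℕ k) (fromℕ k) M))
    ≈⟨ scale-by-1 _ ⟩
  M (fromℕ k) (fromℕ k) ⊗ det (minor (fromℕ k) (fromℕ k) M)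
    ≈⟨ ⊗-congˡ (M (fromℕ k) (fromℕ k)) (det-≡ λ p q → cong₂ M (punchIn-fromℕ p) (punchIn-fromℕ q)) ⟩
  M (fromℕ k) (fromℕ k) ⊗ det (λ p q → M (inject₁ p) (inject₁ q)) ∎
  where open ≈-Reasoning

det-lastRow-offDiagonal : ∀ k (M : Mat (suc (suc k))) (u : Fin (suc k)) →
  (∀ j → j ≢ inject₁ u → M (fromℕ (suc k)) j ≈ []) →
  (∀ r → r ≢ fromℕ (suc k) → r ≢ inject₁ u → M r (fromℕ (suc k)) ≈ []) →
  det M ≈ scale (ℤ.- + 1) ((M (fromℕ (suc k)) (inject₁ u) ⊗ M (inject₁ u) (fromℕ (suc k)))
                            ⊗ det (λ p q → M (inject₁ (punchIn u p)) (inject₁ (punchIn u q))))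
det-lastRow-offDiagonal k M u row col = begin
  det M
    ≈⟨ det-lastRow-single (suc k) M U row ⟩
  scale (sign (suc k + toℕ U)) (M ℓ U ⊗ det N)
    ≈⟨ scale-cong _ (⊗-congˡ (M ℓ U) det-N) ⟩
  scale (sign (suc k + toℕ U)) (M ℓ U ⊗ scale (sign (toℕ u + k)) (M U ℓ ⊗ det Q))
    ≈⟨ scale-cong _ (≈-sym (scale-⊗ʳ _ (M ℓ U) _)) ⟩
  scale (sign (suc k + toℕ U)) (scale (sign (toℕ u + k)) (M ℓ U ⊗ (M U ℓ ⊗ det Q)))
    ≈⟨ scale-assoc _ _ _ ⟩
  scale (sign (suc k + toℕ U) ℤ.* sign (toℕ u + k)) (M ℓ U ⊗ (M U ℓ ⊗ det Q))
    ≈⟨ scale-congʳ _ signs ⟩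
  scale (ℤ.- + 1) (M ℓ U ⊗ (M U ℓ ⊗ det Q))
    ≈⟨ scale-cong _ (⊗-assoc (M ℓ U) (M U ℓ) (det Q)) ⟨
  scale (ℤ.- + 1) ((M ℓ U ⊗ M U ℓ) ⊗ det Q) ∎
  where
  open ≈-Reasoning
  ℓ = fromℕ (suc k)
  U = inject₁ u
  N = minor ℓ U M
  Q : Mat k
  Q p q = M (inject₁ (punchIn u p)) (inject₁ (punchIn u q))
  N-lastCol : ∀ r → N r (fromℕ k) ≡ M (inject₁ r) ℓ
  N-lastCol r = cong₂ M (punchIn-fromℕ r) (punchIn-inject₁-fromℕ u)
  det-N : det N ≈ scale (sign (toℕ u + k)) (M U ℓ ⊗ det Q)
  det-N = ≈-trans
    (det-lastCol-single k N u λ r r≢u → ≈-trans (≡⇒≈ (N-lastCol r))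
      (col (inject₁ r) (Finₚ.fromℕ≢inject₁ ∘ sym) (r≢u ∘ Finₚ.inject₁-injective)))
    (scale-cong _ (⊗-cong (≡⇒≈ (N-lastCol u)) (det-≡ λ p q → cong₂ M (punchIn-fromℕ (punchIn u p))
      (trans (cong (punchIn U) (punchIn-fromℕ q)) (punchIn-inject₁ u q)))))
  signs : sign (suc k + toℕ U) ℤ.* sign (toℕ u + k) ≡ ℤ.- + 1
  signs = trans (cong (λ t → sign (suc k + t) ℤ.* sign (toℕ u + k)) (Finₚ.toℕ-inject₁ u))
                (sign[1+a+b]*sign[b+a]≡-1 k (toℕ u))

replaceLastRow : ∀ {n} → Mat (suc n) → (Fin (suc n) → Poly) → Mat (suc n)
replaceLastRow {n} M row r c with r Fin.≟ fromℕ n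
... | yes _ = row c
... | no  _ = M r c

replaceLastRow-last : ∀ {n} (M : Mat (suc n)) row c → replaceLastRow M row (fromℕ n) c ≡ row c
replaceLastRow-last {n} M row c with fromℕ n Fin.≟ fromℕ n
... | yes _   = refl
... | no  ℓ≢ℓ = ⊥-elim (ℓ≢ℓ refl)

replaceLastRow-other : ∀ {n} (M : Mat (suc n)) row {r} c → r ≢ fromℕ n → replaceLastRow M row r c ≡ M r c
replaceLastRow-other {n} M row {r} c r≢ℓ with r Fin.≟ fromℕ n
... | yes r≡ℓ = ⊥-elim (r≢ℓ r≡ℓ)
... | no  _   = refl

onlyAt : ∀ {n} → Fin n → Poly → Fin n → Poly
onlyAt t v c with c Fin.≟ t
... | yes _ = v
... | no  _ = []

onlyAt-at : ∀ {n} (t : Fin n) v → onlyAt t v t ≡ v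
onlyAt-at t v with t Fin.≟ t
... | yes _   = refl
... | no  t≢t = ⊥-elim (t≢t refl)

onlyAt-other : ∀ {n} (t : Fin n) v {c} → c ≢ t → onlyAt t v c ≡ []
onlyAt-other t v {c} c≢t with c Fin.≟ t
... | yes c≡t = ⊥-elim (c≢t c≡t)
... | no  _   = refl

replaceLastRow-inject₁ : ∀ {n} (M : Mat (suc n)) row (r : Fin n) c →
  replaceLastRow M row (inject₁ r) c ≡ M (inject₁ r) c
replaceLastRow-inject₁ M row r c = replaceLastRow-other M row c (Finₚ.fromℕ≢inject₁ ∘ sym)

det-replaceLastRow-⊕ : ∀ n (M : Mat (suc n)) row₁ row₂ → (∀ c → M (fromℕ n) c ≈ row₁ c ⊕ row₂ c) →
  det M ≈ det (replaceLastRow M row₁) ⊕ det (replaceLastRow M row₂)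
det-replaceLastRow-⊕ n M row₁ row₂ split =
  det-lastRow-additive n M (replaceLastRow M row₁) (replaceLastRow M row₂)
  (λ r c → ≡⇒≈ (sym (replaceLastRow-inject₁ M row₁ r c)))
  (λ r c → ≡⇒≈ (sym (replaceLastRow-inject₁ M row₂ r c)))
  (λ c → ≈-trans (split c) (≡⇒≈ (sym (cong₂ _⊕_ (replaceLastRow-last M row₁ c) (replaceLastRow-last M row₂ c)))))

onlyAt-split : ∀ {n} (f : Fin n → Poly) {t t′} → t ≢ t′ → (∀ c → c ≢ t → c ≢ t′ → f c ≈ []) →
  ∀ c → f c ≈ onlyAt t (f t) c ⊕ onlyAt t′ (f t′) c
onlyAt-split f {t} {t′} t≢t′ f≈[] c with c Fin.≟ t | c Fin.≟ t′
... | yes refl | yes c≡t′ = ⊥-elim (t≢t′ c≡t′)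
... | yes refl | no  _    = ≈-sym (⊕-identityʳ (f t))
... | no  _    | yes refl = ≈-refl
... | no  c≢t  | no  c≢t′ = f≈[] c c≢t c≢t′

det-pendant : ∀ k (M : Mat (suc (suc k))) (u : Fin (suc k)) →
  (∀ j → j ≢ fromℕ (suc k) → j ≢ inject₁ u → M (fromℕ (suc k)) j ≈ []) →
  (∀ r → r ≢ fromℕ (suc k) → r ≢ inject₁ u → M r (fromℕ (suc k)) ≈ []) →
  det M ≈ (M (fromℕ (suc k)) (fromℕ (suc k)) ⊗ det (λ p q → M (inject₁ p) (inject₁ q)))
          ⊕ scale (ℤ.- + 1) ((M (fromℕ (suc k)) (inject₁ u) ⊗ M (inject₁ u) (fromℕ (suc k)))
                              ⊗ det (λ p q → M (inject₁ (punchIn u p)) (inject₁ (punchIn u q))))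
det-pendant k M u row col = ≈-trans
  (det-replaceLastRow-⊕ (suc k) M rowℓ rowU (onlyAt-split (M ℓ) Finₚ.fromℕ≢inject₁ row))
  (⊕-cong det-A det-B)
  where
  ℓ = fromℕ (suc k)
  U = inject₁ u
  rowℓ = onlyAt ℓ (M ℓ ℓ)
  rowU = onlyAt U (M ℓ U)
  det-A : det (replaceLastRow M rowℓ) ≈ M ℓ ℓ ⊗ det (λ p q → M (inject₁ p) (inject₁ q))
  det-A = ≈-trans
    (det-lastRow-diagonal (suc k) (replaceLastRow M rowℓ) λ j j≢ℓ → ≡⇒≈ (trans (replaceLastRow-last M rowℓ j) (onlyAt-other ℓ _ j≢ℓ)))
    (⊗-cong (≡⇒≈ (trans (replaceLastRow-last M rowℓ ℓ) (onlyAt-at ℓ _)))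
            (det-≡ λ p q → replaceLastRow-inject₁ M rowℓ p (inject₁ q)))
  det-B : det (replaceLastRow M rowU)
    ≈ scale (ℤ.- + 1) ((M ℓ U ⊗ M U ℓ) ⊗ det (λ p q → M (inject₁ (punchIn u p)) (inject₁ (punchIn u q))))
  det-B = ≈-trans
    (det-lastRow-offDiagonal k (replaceLastRow M rowU) u
      (λ j j≢U → ≡⇒≈ (trans (replaceLastRow-last M rowU j) (onlyAt-other U _ j≢U)))
      (λ r r≢ℓ r≢U → ≈-trans (≡⇒≈ (replaceLastRow-other M rowU ℓ r≢ℓ)) (col r r≢ℓ r≢U)))
    (scale-cong _ (⊗-cong (⊗-cong (≡⇒≈ (trans (replaceLastRow-last M rowU U) (onlyAt-at U _)))
                                  (≡⇒≈ (replaceLastRow-inject₁ M rowU u ℓ)))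
                          (det-≡ λ p q → replaceLastRow-inject₁ M rowU (punchIn u p) (inject₁ (punchIn u q)))))

anyF-true : ∀ {n} (f : Fin n → Bool) i → f i ≡ true → anyF f ≡ true
anyF-true f zero    fi≡true rewrite fi≡true = refl
anyF-true f (suc i) fi≡true with f zero
... | true  = refl
... | false = anyF-true (f ∘ suc) i fi≡true

anyF-false : ∀ {n} (f : Fin n → Bool) → (∀ i → f i ≡ false) → anyF f ≡ false
anyF-false {zero}  f all-false = refl
anyF-false {suc n} f all-false rewrite all-false zero = anyF-false (f ∘ suc) (all-false ∘ suc)

anyF-witness : ∀ {n} (f : Fin n → Bool) → anyF f ≡ true → ∃ λ i → f i ≡ true
anyF-witness {suc n} f any≡true with f zero in f0
... | true  = zero , f0
... | false with anyF-witness (f ∘ suc) any≡true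
...   | i , fi = suc i , fi

≤-maxF : ∀ {n} (f : Fin n → ℕ) i → f i ≤ maxF f
≤-maxF f zero    = ℕₚ.m≤m⊔n _ _
≤-maxF f (suc i) = ℕₚ.≤-trans (≤-maxF (f ∘ suc) i) (ℕₚ.m≤n⊔m _ _)

maxF-≤ : ∀ {n} (f : Fin n → ℕ) {m} → (∀ i → f i ≤ m) → maxF f ≤ m
maxF-≤ {zero}  f f≤m = z≤n
maxF-≤ {suc n} f f≤m = ℕₚ.⊔-lub (f≤m zero) (maxF-≤ (f ∘ suc) (f≤m ∘ suc))

maxF-attained : ∀ {n} (f : Fin n → ℕ) {m} i → (∀ j → f j ≤ m) → f i ≡ m → maxF f ≡ m
maxF-attained f i f≤m fi≡m = ℕₚ.≤-antisym (maxF-≤ f f≤m) (subst (_≤ maxF f) fi≡m (≤-maxF f i))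

search-suc : ∀ (p : ℕ → Bool) k f → search p (suc k) f ≡ suc (search (p ∘ suc) k f)
search-suc p k zero    = refl
search-suc p k (suc f) with p (suc k)
... | true  = refl
... | false = search-suc p (suc k) f

search-least : ∀ (p : ℕ → Bool) f d → (∀ j → j <ℕ d → p j ≡ false) → p d ≡ true → d ≤ f →
  search p 0 (suc f) ≡ d
search-least p f       zero    below pd z≤n rewrite pd = refl
search-least p (suc f) (suc d) below pd (s≤s d≤f) rewrite below 0 (s≤s z≤n) =
  trans (search-suc p 0 (suc f))
        (cong suc (search-least (p ∘ suc) f d (λ j j<d → below (suc j) (s≤s j<d)) pd d≤f))

-- Roles of the vertices of T and distances in its complement

-- v₁ and v₂ are the centres; leafᵢ is a leaf adjacent to centreᵢ.
data Role : Set where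
  leaf₁ centre₁ centre₂ leaf₂ : Role

arcᵀ : Role → Role → Bool
arcᵀ leaf₁   centre₁ = true
arcᵀ centre₁ centre₂ = true
arcᵀ centre₂ leaf₂   = true
arcᵀ _       _       = false

adjacentᵀ : Role → Role → Bool
adjacentᵀ t s = arcᵀ t s ∨ arcᵀ s t

-- How two distinct vertices with roles t and s are joined in the complement of T:
-- directly, through a vertex of role m, or (for the two centres) only through two vertices.
data Link : Role → Role → Set where
  direct : ∀ {t s} → adjacentᵀ t s ≡ false → Link t s
  via    : ∀ {t s} m → adjacentᵀ t s ≡ true → t ≢ m → m ≢ s →
           adjacentᵀ t m ≡ false → adjacentᵀ m s ≡ false → Link t s
  via₂   : ∀ {t s} m₁ m₂ → adjacentᵀ t s ≡ true → (∀ x → adjacentᵀ t x ≡ false → adjacentᵀ x s ≡ true) →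
           t ≢ m₁ → m₁ ≢ m₂ → m₂ ≢ s →
           adjacentᵀ t m₁ ≡ false → adjacentᵀ m₁ m₂ ≡ false → adjacentᵀ m₂ s ≡ false → Link t s

link : ∀ t s → Link t s
link leaf₁   leaf₁   = direct refl
link leaf₁   centre₁ = via leaf₂ refl (λ ()) (λ ()) refl refl
link leaf₁   centre₂ = direct refl
link leaf₁   leaf₂   = direct refl
link centre₁ leaf₁   = via leaf₂ refl (λ ()) (λ ()) refl refl
link centre₁ centre₁ = direct refl
link centre₁ centre₂ = via₂ leaf₂ leaf₁ refl (λ { centre₁ _ → refl ; leaf₂ _ → refl })
                            (λ ()) (λ ()) (λ ()) refl refl refl
link centre₁ leaf₂   = direct refl
link centre₂ leaf₁   = direct refl
link centre₂ centre₁ = via₂ leaf₁ leaf₂ refl (λ { leaf₁ _ → refl ; centre₂ _ → refl })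
                            (λ ()) (λ ()) (λ ()) refl refl refl
link centre₂ centre₂ = direct refl
link centre₂ leaf₂   = via leaf₁ refl (λ ()) (λ ()) refl refl
link leaf₂   leaf₁   = direct refl
link leaf₂   centre₁ = direct refl
link leaf₂   centre₂ = via leaf₁ refl (λ ()) (λ ()) refl refl
link leaf₂   leaf₂   = direct refl

linkLength : ∀ {t s} → Link t s → ℕ
linkLength (direct _)                 = 1
linkLength (via _ _ _ _ _ _)          = 2
linkLength (via₂ _ _ _ _ _ _ _ _ _ _) = 3

linkLength≤3 : ∀ {t s} (l : Link t s) → linkLength l ≤ 3
linkLength≤3 (direct _)                 = s≤s z≤n
linkLength≤3 (via _ _ _ _ _ _)          = s≤s (s≤s z≤n)
linkLength≤3 (via₂ _ _ _ _ _ _ _ _ _ _) = ℕₚ.≤-refl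

roleDist : Role → Role → ℕ
roleDist t s = linkLength (link t s)

roleAt : Fin 4 → Role
roleAt zero                   = leaf₁
roleAt (suc zero)             = centre₁
roleAt (suc (suc zero))       = centre₂
roleAt (suc (suc (suc zero))) = leaf₂

indexOf : Role → Fin 4
indexOf leaf₁   = zero
indexOf centre₁ = suc zero
indexOf centre₂ = suc (suc zero)
indexOf leaf₂   = suc (suc (suc zero))

roleAt-indexOf : ∀ t → roleAt (indexOf t) ≡ t
roleAt-indexOf leaf₁   = refl
roleAt-indexOf centre₁ = refl
roleAt-indexOf centre₂ = refl
roleAt-indexOf leaf₂   = refl

roleEcc : Role → ℕ
roleEcc t = maxF (roleDist t ∘ roleAt)

roleDist≤roleEcc : ∀ t s → roleDist t s ≤ roleEcc t
roleDist≤roleEcc t s = subst (_≤ roleEcc t) (cong (roleDist t) (roleAt-indexOf s))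
                             (≤-maxF (roleDist t ∘ roleAt) (indexOf s))

farthest : Role → Role
farthest leaf₁   = centre₁
farthest centre₁ = centre₂
farthest centre₂ = centre₁
farthest leaf₂   = centre₂

farthest≢ : ∀ t → t ≢ farthest t
farthest≢ leaf₁   ()
farthest≢ centre₁ ()
farthest≢ centre₂ ()
farthest≢ leaf₂   ()

roleDist-farthest : ∀ t → roleDist t (farthest t) ≡ roleEcc t
roleDist-farthest leaf₁   = refl
roleDist-farthest centre₁ = refl
roleDist-farthest centre₂ = refl
roleDist-farthest leaf₂   = refl

-- The entry of the eccentricity matrix between distinct vertices of roles t and s.
weight : Role → Role → ℕ
weight t s = if roleDist t s ≡ᵇ (roleEcc t ⊓ roleEcc s) then roleDist t s else 0

==-refl : ∀ {n} (u : Fin n) → (u == u) ≡ true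
==-refl u = Equivalence.to Boolₚ.T-≡ (ℕₚ.≡⇒≡ᵇ (toℕ u) (toℕ u) refl)

==⇒≡ : ∀ {n} {u v : Fin n} → (u == v) ≡ true → u ≡ v
==⇒≡ {u = u} {v} e = Finₚ.toℕ-injective (ℕₚ.≡ᵇ⇒≡ (toℕ u) (toℕ v) (Equivalence.from Boolₚ.T-≡ e))

≢⇒==-false : ∀ {n} {u v : Fin n} → u ≢ v → (u == v) ≡ false
≢⇒==-false {u = u} {v} u≢v with u == v in e
... | true  = ⊥-elim (u≢v (==⇒≡ e))
... | false = refl

==-injective : ∀ {n m} (f : Fin n → Fin m) → (∀ {p q} → f p ≡ f q → p ≡ q) →
  ∀ p q → (f p == f q) ≡ (p == q)
==-injective f f-inj p q with p Fin.≟ q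
... | yes refl = trans (==-refl (f p)) (sym (==-refl p))
... | no  p≢q  = trans (≢⇒==-false (p≢q ∘ f-inj)) (sym (≢⇒==-false p≢q))

punchInℕ : ℕ → ℕ → ℕ
punchInℕ i t = if t <ᵇ i then t else suc t

toℕ-punchIn : ∀ {n} (u : Fin (suc n)) (p : Fin n) → toℕ (punchIn u p) ≡ punchInℕ (toℕ u) (toℕ p)
toℕ-punchIn zero    p       = refl
toℕ-punchIn (suc u) zero    = refl
toℕ-punchIn (suc u) (suc p) with toℕ p <ᵇ toℕ u | toℕ-punchIn u p
... | true  | e = cong suc e
... | false | e = cong suc e

X : Poly
X = + 0 ∷ + 1 ∷ []

charEntry : Bool → Role → Role → Poly
charEntry true  t s = X
charEntry false t s = ℤ.- + weight t s ∷ []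

charMatrix : ∀ {m} → (ℕ → Role) → Mat m
charMatrix τ u v = charEntry (u == v) (τ (toℕ u)) (τ (toℕ v))

det-charMatrix-cong : ∀ {m} {τ τ′ : ℕ → Role} → (∀ t → t <ℕ m → τ t ≡ τ′ t) →
  det (charMatrix {m} τ) ≈ det (charMatrix {m} τ′)
det-charMatrix-cong e = det-≡ λ p q →
  cong₂ (charEntry (p == q)) (e (toℕ p) (Finₚ.toℕ<n p)) (e (toℕ q) (Finₚ.toℕ<n q))

charMatrix-diagonal : ∀ {m} (τ : ℕ → Role) (u : Fin m) → charMatrix τ u u ≡ X
charMatrix-diagonal τ u = cong (λ b → charEntry b (τ (toℕ u)) (τ (toℕ u))) (==-refl u)

charMatrix-inject₁ : ∀ {m} (τ : ℕ → Role) (p q : Fin m) →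
  charMatrix τ (inject₁ p) (inject₁ q) ≡ charMatrix τ p q
charMatrix-inject₁ τ p q = cong₂ (λ b (ts : Role × Role) → charEntry b (proj₁ ts) (proj₂ ts))
  (==-injective inject₁ Finₚ.inject₁-injective p q)
  (cong₂ _,_ (cong τ (Finₚ.toℕ-inject₁ p)) (cong τ (Finₚ.toℕ-inject₁ q)))

charMatrix-punchIn : ∀ {m} (τ : ℕ → Role) (u : Fin (suc m)) (p q : Fin m) →
  charMatrix τ (inject₁ (punchIn u p)) (inject₁ (punchIn u q)) ≡ charMatrix (τ ∘ punchInℕ (toℕ u)) p q
charMatrix-punchIn τ u p q = trans (charMatrix-inject₁ τ (punchIn u p) (punchIn u q))
  (cong₂ (λ b (ts : Role × Role) → charEntry b (proj₁ ts) (proj₂ ts))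
    (==-injective (punchIn u) (Finₚ.punchIn-injective u _ _) p q)
    (cong₂ _,_ (cong τ (toℕ-punchIn u p)) (cong τ (toℕ-punchIn u q))))

charMatrix-off : ∀ {m} (τ : ℕ → Role) {u v : Fin m} → u ≢ v →
  weight (τ (toℕ u)) (τ (toℕ v)) ≡ 0 → charMatrix τ u v ≈ []
charMatrix-off τ u≢v w≡0 rewrite ≢⇒==-false u≢v | w≡0 = 0∷-zero ≈-refl

data _LeafOf_ : Role → Role → Set where
  leaf₁-centre₁ : leaf₁ LeafOf centre₁
  leaf₂-centre₂ : leaf₂ LeafOf centre₂

weight-leaf-centre : ∀ {l c} → l LeafOf c → (weight l c ≡ 2) × (weight c l ≡ 2)
weight-leaf-centre leaf₁-centre₁ = refl , refl
weight-leaf-centre leaf₂-centre₂ = refl , refl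

weight-leaf-other : ∀ {l c} → l LeafOf c → ∀ s → s ≢ c → (weight l s ≡ 0) × (weight s l ≡ 0)
weight-leaf-other leaf₁-centre₁ leaf₁   _   = refl , refl
weight-leaf-other leaf₁-centre₁ centre₁ s≢c = ⊥-elim (s≢c refl)
weight-leaf-other leaf₁-centre₁ centre₂ _   = refl , refl
weight-leaf-other leaf₁-centre₁ leaf₂   _   = refl , refl
weight-leaf-other leaf₂-centre₂ leaf₁   _   = refl , refl
weight-leaf-other leaf₂-centre₂ centre₁ _   = refl , refl
weight-leaf-other leaf₂-centre₂ centre₂ s≢c = ⊥-elim (s≢c refl)
weight-leaf-other leaf₂-centre₂ leaf₂   _   = refl , refl

det-charMatrix-orphan : ∀ K (τ : ℕ → Role) {l c} → l LeafOf c → τ K ≡ l → (∀ t → τ t ≢ c) →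
  det (charMatrix {suc K} τ) ≈ X ⊗ det (charMatrix {K} τ)
det-charMatrix-orphan K τ lc τK≡l no-c = ≈-trans
  (det-lastRow-diagonal K (charMatrix τ) λ j j≢ℓ → charMatrix-off τ (j≢ℓ ∘ sym) (zero-weight j))
  (⊗-cong (≡⇒≈ (charMatrix-diagonal {suc K} τ (fromℕ K))) (det-≡ (charMatrix-inject₁ {K} τ)))
  where
  zero-weight : ∀ (j : Fin (suc K)) → weight (τ (toℕ (fromℕ K))) (τ (toℕ j)) ≡ 0
  zero-weight j = trans (cong (λ t → weight t (τ (toℕ j))) (trans (cong τ (Finₚ.toℕ-fromℕ K)) τK≡l))
                        (proj₁ (weight-leaf-other lc (τ (toℕ j)) (no-c (toℕ j))))

det-charMatrix-leaf : ∀ K (τ : ℕ → Role) (u : Fin (suc K)) {l c} → l LeafOf c →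
  τ (suc K) ≡ l → τ (toℕ u) ≡ c → (∀ t → τ t ≡ c → t ≡ toℕ u) →
  det (charMatrix {suc (suc K)} τ)
    ≈ (X ⊗ det (charMatrix {suc K} τ)) ⊕ scale (ℤ.- + 4) (det (charMatrix {K} (τ ∘ punchInℕ (toℕ u))))
det-charMatrix-leaf K τ u {l} {c} lc τℓ≡l τu≡c c-unique = begin
  det (charMatrix {suc (suc K)} τ)
    ≈⟨ det-pendant K (charMatrix τ) u
         (λ j j≢ℓ j≢U → charMatrix-off τ (j≢ℓ ∘ sym) (proj₁ (others j j≢U)))
         (λ r r≢ℓ r≢U → charMatrix-off τ r≢ℓ (proj₂ (others r r≢U))) ⟩
  (charMatrix τ ℓ ℓ ⊗ det {suc K} (λ p q → charMatrix τ (inject₁ p) (inject₁ q)))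
    ⊕ scale (ℤ.- + 1) ((charMatrix τ ℓ U ⊗ charMatrix τ U ℓ)
                       ⊗ det {K} (λ p q → charMatrix τ (inject₁ (punchIn u p)) (inject₁ (punchIn u q))))
    ≈⟨ ⊕-cong (⊗-cong (≡⇒≈ (charMatrix-diagonal {suc (suc K)} τ ℓ)) (det-≡ (charMatrix-inject₁ {suc K} τ)))
              (scale-cong _ (⊗-cong (≡⇒≈ edge-weights) (det-≡ (charMatrix-punchIn {K} τ u)))) ⟩
  (X ⊗ D₁) ⊕ scale (ℤ.- + 1) (((ℤ.- + 2 ∷ []) ⊗ (ℤ.- + 2 ∷ [])) ⊗ D₀)
    ≈⟨ ⊕-congˡ (X ⊗ D₁) (scale-cong (ℤ.- + 1) (⊕-congˡ (scale (+ 4) D₀) (0∷-zero ≈-refl))) ⟩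
  (X ⊗ D₁) ⊕ scale (ℤ.- + 1) (scale (+ 4) D₀ ⊕ [])
    ≈⟨ ⊕-congˡ (X ⊗ D₁) (scale-cong (ℤ.- + 1) (⊕-identityʳ (scale (+ 4) D₀))) ⟩
  (X ⊗ D₁) ⊕ scale (ℤ.- + 1) (scale (+ 4) D₀)
    ≈⟨ ⊕-congˡ (X ⊗ D₁) (scale-assoc (ℤ.- + 1) (+ 4) D₀) ⟩
  (X ⊗ D₁) ⊕ scale (ℤ.- + 4) D₀ ∎
  where
  open ≈-Reasoning
  D₁ = det (charMatrix {suc K} τ)
  D₀ = det (charMatrix {K} (τ ∘ punchInℕ (toℕ u)))
  ℓ = fromℕ (suc K)
  U = inject₁ u
  τℓ : τ (toℕ ℓ) ≡ l
  τℓ = trans (cong τ (Finₚ.toℕ-fromℕ (suc K))) τℓ≡l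
  τU : τ (toℕ U) ≡ c
  τU = trans (cong τ (Finₚ.toℕ-inject₁ u)) τu≡c
  others : ∀ j → j ≢ U → (weight (τ (toℕ ℓ)) (τ (toℕ j)) ≡ 0) × (weight (τ (toℕ j)) (τ (toℕ ℓ)) ≡ 0)
  others j j≢U rewrite τℓ = weight-leaf-other lc (τ (toℕ j)) λ τj≡c →
    j≢U (Finₚ.toℕ-injective (trans (c-unique (toℕ j) τj≡c) (sym (Finₚ.toℕ-inject₁ u))))
  edge-weights : charMatrix τ ℓ U ⊗ charMatrix τ U ℓ ≡ (ℤ.- + 2 ∷ []) ⊗ (ℤ.- + 2 ∷ [])
  edge-weights rewrite ≢⇒==-false (Finₚ.fromℕ≢inject₁ {i = u}) | ≢⇒==-false (Finₚ.fromℕ≢inject₁ {i = u} ∘ sym)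
                     | τℓ | τU | proj₁ (weight-leaf-centre lc) | proj₂ (weight-leaf-centre lc) = refl

-- Role layouts and their characteristic polynomials

pendantRole : ℕ → ℕ → Role
pendantRole a k = if k <ᵇ a then leaf₁ else leaf₂

-- The roles rs, followed by a pendant leaves at centre₁ and then pendant leaves at centre₂
-- (as many as the matrix size allows).
layout : List Role → ℕ → ℕ → Role
layout []       a k       = pendantRole a k
layout (r ∷ rs) a zero    = r
layout (r ∷ rs) a (suc t) = layout rs a t

<⇒<ᵇ≡true : ∀ {m n} → m <ℕ n → (m <ᵇ n) ≡ true
<⇒<ᵇ≡true m<n = Equivalence.to Boolₚ.T-≡ (ℕₚ.<⇒<ᵇ m<n)

≤⇒<ᵇ≡false : ∀ {m n} → n ≤ m → (m <ᵇ n) ≡ false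
≤⇒<ᵇ≡false {m} {n} n≤m with m <ᵇ n in m<ᵇn
... | false = refl
... | true  = ⊥-elim (ℕₚ.≤⇒≯ n≤m (ℕₚ.<ᵇ⇒< m n (Equivalence.from Boolₚ.T-≡ m<ᵇn)))

<ᵇ≡true⇒< : ∀ m n → (m <ᵇ n) ≡ true → m <ℕ n
<ᵇ≡true⇒< m n e = ℕₚ.<ᵇ⇒< m n (Equivalence.from Boolₚ.T-≡ e)

<ᵇ≡false⇒≤ : ∀ m n → (m <ᵇ n) ≡ false → n ≤ m
<ᵇ≡false⇒≤ m n e = ℕₚ.≮⇒≥ λ m<n → subst T e (ℕₚ.<⇒<ᵇ m<n)

pendantRole-leaf₁ : ∀ a k → k <ℕ a → pendantRole a k ≡ leaf₁
pendantRole-leaf₁ a k k<a rewrite <⇒<ᵇ≡true k<a = refl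

pendantRole-leaf₂ : ∀ a k → a ≤ k → pendantRole a k ≡ leaf₂
pendantRole-leaf₂ a k a≤k rewrite ≤⇒<ᵇ≡false a≤k = refl

pendantRole≢centre : ∀ {l c} → l LeafOf c → ∀ a k → pendantRole a k ≢ c
pendantRole≢centre leaf₁-centre₁ a k with k <ᵇ a
... | true  = λ ()
... | false = λ ()
pendantRole≢centre leaf₂-centre₂ a k with k <ᵇ a
... | true  = λ ()
... | false = λ ()

layout-suc : ∀ rs a t → t <ℕ length rs + a → layout rs (suc a) t ≡ layout rs a t
layout-suc []       a t       t<a = trans (pendantRole-leaf₁ (suc a) t (ℕₚ.m<n⇒m<1+n t<a))
                                          (sym (pendantRole-leaf₁ a t t<a))
layout-suc (r ∷ rs) a zero    _   = refl
layout-suc (r ∷ rs) a (suc t) t<  = layout-suc rs a t (ℕₚ.≤-pred t<)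

layout-punchIn : ∀ xs r ys a t →
  layout (xs ++ r ∷ ys) a (punchInℕ (length xs) t) ≡ layout (xs ++ ys) a t
layout-punchIn []       r ys a t       = refl
layout-punchIn (x ∷ xs) r ys a zero    = refl
layout-punchIn (x ∷ xs) r ys a (suc t) with t <ᵇ length xs | layout-punchIn xs r ys a t
... | true  | e = e
... | false | e = e

layout-absent : ∀ {l c} → l LeafOf c → ∀ rs a → All (_≢ c) rs → ∀ t → layout rs a t ≢ c
layout-absent lc []       a []          t       = pendantRole≢centre lc a t
layout-absent lc (r ∷ rs) a (r≢c ∷ _)   zero    = r≢c
layout-absent lc (r ∷ rs) a (_ ∷ rs≢c)  (suc t) = layout-absent lc rs a rs≢c t

layout-unique : ∀ {l c} → l LeafOf c → ∀ xs ys a → All (_≢ c) xs → All (_≢ c) ys →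
  ∀ t → layout (xs ++ c ∷ ys) a t ≡ c → t ≡ length xs
layout-unique lc []       ys a []          ys≢c zero    _ = refl
layout-unique lc []       ys a []          ys≢c (suc t) e = ⊥-elim (layout-absent lc ys a ys≢c t e)
layout-unique lc (x ∷ xs) ys a (x≢c ∷ _)   ys≢c zero    e = ⊥-elim (x≢c e)
layout-unique lc (x ∷ xs) ys a (_ ∷ xs≢c)  ys≢c (suc t) e = cong suc (layout-unique lc xs ys a xs≢c ys≢c t e)

det-layout-suc : ∀ rs a →
  det (charMatrix {length rs + a} (layout rs (suc a))) ≈ det (charMatrix {length rs + a} (layout rs a))
det-layout-suc rs a = det-charMatrix-cong (layout-suc rs a)

det-layout-punchIn : ∀ {m} xs r ys a →
  det (charMatrix {m} (layout (xs ++ r ∷ ys) a ∘ punchInℕ (length xs))) ≈ det (charMatrix {m} (layout (xs ++ ys) a))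
det-layout-punchIn {m} xs r ys a = det-charMatrix-cong {m} λ t _ → layout-punchIn xs r ys a t

x^_·_ : ℕ → Poly → Poly
x^ k · p = replicate k (+ 0) ++ p

quartic : ℕ → ℕ → Poly
quartic a b = + (16 * (suc a * suc b)) ∷ + 0 ∷ ℤ.- + (4 * (a + b + 4) + 1) ∷ + 0 ∷ + 1 ∷ []

χ₁ χ₂ χ₀ : ℕ → ℕ → Poly
χ₁ a b = x^ suc (a + b) · (ℤ.- + (4 * suc a) ∷ + 0 ∷ + 1 ∷ [])
χ₂ a b = x^ suc (a + b) · (ℤ.- + (4 * suc b) ∷ + 0 ∷ + 1 ∷ [])
χ₀ a b = x^ suc (suc (a + b)) · (+ 1 ∷ [])

x^-cong : ∀ k {p q} → p ≈ q → x^ k · p ≈ x^ k · q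
x^-cong zero    e = e
x^-cong (suc k) e = ∷-cong refl (x^-cong k e)

x^-⊕ : ∀ k p q → (x^ k · p) ⊕ (x^ k · q) ≈ x^ k · (p ⊕ q)
x^-⊕ zero    p q = ≈-refl
x^-⊕ (suc k) p q = ∷-cong refl (x^-⊕ k p q)

x^-scale : ∀ k c p → scale c (x^ k · p) ≈ x^ k · scale c p
x^-scale zero    c p = ≈-refl
x^-scale (suc k) c p = ∷-cong (ℤₚ.*-zeroʳ c) (x^-scale k c p)

X-⊗ : ∀ p → X ⊗ p ≈ + 0 ∷ p
X-⊗ p = ≈-trans (⊕-congʳ (+ 0 ∷ ((+ 1 ∷ []) ⊗ p)) (scale-by-0 p)) (∷-cong refl (⊗-identityˡ p))

x^-step : ∀ k p q c → (X ⊗ (x^ k · p)) ⊕ scale c (x^ suc k · q) ≈ x^ suc k · (p ⊕ scale c q)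
x^-step k p q c = ≈-trans (⊕-cong (X-⊗ (x^ k · p)) (x^-scale (suc k) c q)) (x^-⊕ (suc k) p (scale c q))

ℤ-add-4k : ∀ m k n → m + 4 * k ≡ n → + m ℤ.+ ℤ.- + 4 ℤ.* ℤ.- + k ≡ + n
ℤ-add-4k m k n e = begin
  + m ℤ.+ ℤ.- + 4 ℤ.* ℤ.- + k ≡⟨ cong (λ t → + m ℤ.+ t) (ℤₚ.neg-distribˡ-* (+ 4) (ℤ.- + k)) ⟨
  + m ℤ.+ ℤ.- (+ 4 ℤ.* ℤ.- + k) ≡⟨ cong (λ t → + m ℤ.+ ℤ.- t) (ℤₚ.neg-distribʳ-* (+ 4) (+ k)) ⟨
  + m ℤ.+ ℤ.- ℤ.- (+ 4 ℤ.* + k) ≡⟨ cong (λ t → + m ℤ.+ t) (ℤₚ.neg-involutive (+ 4 ℤ.* + k)) ⟩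
  + m ℤ.+ + 4 ℤ.* + k           ≡⟨ cong (λ t → + m ℤ.+ t) (ℤₚ.pos-* 4 k) ⟨
  + m ℤ.+ + (4 * k)             ≡⟨ ℤₚ.pos-+ m (4 * k) ⟨
  + (m + 4 * k)                 ≡⟨ cong +_ e ⟩
  + n                           ∎
  where open ≡-Reasoning

ℤ-sub-4 : ∀ m n → m + 4 ≡ n → ℤ.- + m ℤ.+ ℤ.- + 4 ℤ.* + 1 ≡ ℤ.- + n
ℤ-sub-4 m n e = begin
  ℤ.- + m ℤ.+ ℤ.- + 4 ℤ.* + 1 ≡⟨ cong (λ t → ℤ.- + m ℤ.+ t) (ℤₚ.*-identityʳ (ℤ.- + 4)) ⟩
  ℤ.- + m ℤ.+ ℤ.- + 4         ≡⟨ ℤₚ.neg-distrib-+ (+ m) (+ 4) ⟨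
  ℤ.- (+ m ℤ.+ + 4)           ≡⟨ cong ℤ.-_ (ℤₚ.pos-+ m 4) ⟨
  ℤ.- + (m + 4)               ≡⟨ cong (ℤ.-_ ∘ +_) e ⟩
  ℤ.- + n                     ∎
  where open ≡-Reasoning

specPoly-step-b : ∀ a b → (X ⊗ specPoly a b) ⊕ scale (ℤ.- + 4) (χ₁ a b) ≈ specPoly a (suc b)
specPoly-step-b a b = ≈-trans (x^-step (a + b) (quartic a b) _ _)
  (≈-trans (x^-cong (suc (a + b)) (∷-cong c₀ (∷-cong refl (∷-cong c₂ ≈-refl))))
           (≡⇒≈ (cong (λ k → x^ k · quartic a (suc b)) (sym (ℕₚ.+-suc a b)))))
  where
  open ℕ-Solver.+-*-Solver
  c₀ = ℤ-add-4k (16 * (suc a * suc b)) (4 * suc a) (16 * (suc a * suc (suc b)))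
    (solve 2 (λ a b → con 16 :* ((con 1 :+ a) :* (con 1 :+ b)) :+ con 4 :* (con 4 :* (con 1 :+ a))
                   := con 16 :* ((con 1 :+ a) :* (con 2 :+ b))) refl a b)
  c₂ = ℤ-sub-4 (4 * (a + b + 4) + 1) (4 * (a + suc b + 4) + 1)
    (solve 2 (λ a b → con 4 :* (a :+ b :+ con 4) :+ con 1 :+ con 4
                   := con 4 :* (a :+ (con 1 :+ b) :+ con 4) :+ con 1) refl a b)

specPoly-step-a : ∀ a b → (X ⊗ specPoly a b) ⊕ scale (ℤ.- + 4) (χ₂ a b) ≈ specPoly (suc a) b
specPoly-step-a a b = ≈-trans (x^-step (a + b) (quartic a b) _ _)
  (x^-cong (suc (a + b)) (∷-cong c₀ (∷-cong refl (∷-cong c₂ ≈-refl))))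
  where
  open ℕ-Solver.+-*-Solver
  c₀ = ℤ-add-4k (16 * (suc a * suc b)) (4 * suc b) (16 * (suc (suc a) * suc b))
    (solve 2 (λ a b → con 16 :* ((con 1 :+ a) :* (con 1 :+ b)) :+ con 4 :* (con 4 :* (con 1 :+ b))
                   := con 16 :* ((con 2 :+ a) :* (con 1 :+ b))) refl a b)
  c₂ = ℤ-sub-4 (4 * (a + b + 4) + 1) (4 * (suc a + b + 4) + 1)
    (solve 2 (λ a b → con 4 :* (a :+ b :+ con 4) :+ con 1 :+ con 4
                   := con 4 :* ((con 1 :+ a) :+ b :+ con 4) :+ con 1) refl a b)

χ₁-step-b : ∀ a b → X ⊗ χ₁ a b ≈ χ₁ a (suc b)
χ₁-step-b a b = ≈-trans (X-⊗ (χ₁ a b))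
  (≡⇒≈ (cong (λ k → x^ suc k · (ℤ.- + (4 * suc a) ∷ + 0 ∷ + 1 ∷ [])) (sym (ℕₚ.+-suc a b))))

χ₁-step-a : ∀ a b → (X ⊗ χ₁ a b) ⊕ scale (ℤ.- + 4) (χ₀ a b) ≈ χ₁ (suc a) b
χ₁-step-a a b = ≈-trans (x^-step (suc (a + b)) _ _ _) (x^-cong (suc (suc (a + b))) (∷-cong c₀ ≈-refl))
  where
  open ℕ-Solver.+-*-Solver
  c₀ = ℤ-sub-4 (4 * suc a) (4 * suc (suc a))
    (solve 1 (λ a → con 4 :* (con 1 :+ a) :+ con 4 := con 4 :* (con 2 :+ a)) refl a)

χ₂-step-b : ∀ a b → (X ⊗ χ₂ a b) ⊕ scale (ℤ.- + 4) (χ₀ a b) ≈ χ₂ a (suc b)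
χ₂-step-b a b = ≈-trans (x^-step (suc (a + b)) _ _ _)
  (≈-trans (x^-cong (suc (suc (a + b))) (∷-cong c₀ ≈-refl))
           (≡⇒≈ (cong (λ k → x^ suc k · (ℤ.- + (4 * suc (suc b)) ∷ + 0 ∷ + 1 ∷ [])) (sym (ℕₚ.+-suc a b)))))
  where
  open ℕ-Solver.+-*-Solver
  c₀ = ℤ-sub-4 (4 * suc b) (4 * suc (suc b))
    (solve 1 (λ b → con 4 :* (con 1 :+ b) :+ con 4 := con 4 :* (con 2 :+ b)) refl b)

χ₂-step-a : ∀ a b → X ⊗ χ₂ a b ≈ χ₂ (suc a) b
χ₂-step-a a b = X-⊗ (χ₂ a b)

χ₀-step-b : ∀ a b → X ⊗ χ₀ a b ≈ χ₀ a (suc b)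
χ₀-step-b a b = ≈-trans (X-⊗ (χ₀ a b))
  (≡⇒≈ (cong (λ k → x^ suc (suc k) · (+ 1 ∷ [])) (sym (ℕₚ.+-suc a b))))

χ₀-step-a : ∀ a b → X ⊗ χ₀ a b ≈ χ₀ (suc a) b
χ₀-step-a a b = X-⊗ (χ₀ a b)

roles₁₂ roles₁ roles₂ roles₀ : ℕ → ℕ → Role
roles₁₂ = layout (leaf₁ ∷ centre₁ ∷ centre₂ ∷ leaf₂ ∷ [])
roles₁  = layout (leaf₁ ∷ centre₁ ∷ leaf₂ ∷ [])
roles₂  = layout (leaf₁ ∷ centre₂ ∷ leaf₂ ∷ [])
roles₀  = layout (leaf₁ ∷ leaf₂ ∷ [])

ℕ²-induction : {P : ℕ → ℕ → Set} → P 0 0 → (∀ a → P a 0 → P (suc a) 0) →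
  (∀ a b → P a b → P a (suc b)) → ∀ a b → P a b
ℕ²-induction p₀₀ step-a step-b zero    zero    = p₀₀
ℕ²-induction p₀₀ step-a step-b (suc a) zero    = step-a a (ℕ²-induction p₀₀ step-a step-b a zero)
ℕ²-induction p₀₀ step-a step-b a       (suc b) = step-b a b (ℕ²-induction p₀₀ step-a step-b a b)

orphan-recurrence : ∀ {d d₁ p₁ r} → d ≈ X ⊗ d₁ → d₁ ≈ p₁ → X ⊗ p₁ ≈ r → d ≈ r
orphan-recurrence e e₁ rec = ≈-trans e (≈-trans (⊗-congˡ X e₁) rec)

leaf-recurrence : ∀ {d d₁ d₀ p₁ p₀ r} → d ≈ (X ⊗ d₁) ⊕ scale (ℤ.- + 4) d₀ → d₁ ≈ p₁ → d₀ ≈ p₀ →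
  (X ⊗ p₁) ⊕ scale (ℤ.- + 4) p₀ ≈ r → d ≈ r
leaf-recurrence e e₁ e₀ rec = ≈-trans e (≈-trans (⊕-cong (⊗-congˡ X e₁) (scale-cong _ e₀)) rec)

-- Each step deletes the last vertex, the last pendant: at centre₂ if b > 0, else at
-- centre₁. Sizes are written n + (b + a) so that both steps change them definitionally.
det-roles₀ : ∀ a b → det (charMatrix {2 + (b + a)} (roles₀ a)) ≈ χ₀ a b
det-roles₀ = ℕ²-induction (≡⇒≈ refl)
  (λ a ih → orphan-recurrence
    (det-charMatrix-orphan (2 + a) (roles₀ (suc a)) leaf₁-centre₁ (pendantRole-leaf₁ (suc a) a (ℕₚ.n<1+n a))
      (layout-absent leaf₁-centre₁ _ (suc a) ((λ ()) ∷ (λ ()) ∷ [])))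
    (≈-trans (det-layout-suc (leaf₁ ∷ leaf₂ ∷ []) a) ih) (χ₀-step-a a 0))
  (λ a b ih → orphan-recurrence
    (det-charMatrix-orphan (2 + (b + a)) (roles₀ a) leaf₂-centre₂ (pendantRole-leaf₂ a (b + a) (ℕₚ.m≤n+m a b))
      (layout-absent leaf₂-centre₂ _ a ((λ ()) ∷ (λ ()) ∷ [])))
    ih (χ₀-step-b a b))

det-roles₁ : ∀ a b → det (charMatrix {3 + (b + a)} (roles₁ a)) ≈ χ₁ a b
det-roles₁ = ℕ²-induction (≡⇒≈ refl)
  (λ a ih → leaf-recurrence
    (det-charMatrix-leaf (2 + a) (roles₁ (suc a)) (suc zero) leaf₁-centre₁
      (pendantRole-leaf₁ (suc a) a (ℕₚ.n<1+n a)) refl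
      (layout-unique leaf₁-centre₁ (leaf₁ ∷ []) (leaf₂ ∷ []) (suc a) ((λ ()) ∷ []) ((λ ()) ∷ [])))
    (≈-trans (det-layout-suc (leaf₁ ∷ centre₁ ∷ leaf₂ ∷ []) a) ih)
    (≈-trans (det-layout-punchIn {2 + a} (leaf₁ ∷ []) centre₁ (leaf₂ ∷ []) (suc a))
      (≈-trans (det-layout-suc (leaf₁ ∷ leaf₂ ∷ []) a) (det-roles₀ a 0)))
    (χ₁-step-a a 0))
  (λ a b ih → orphan-recurrence
    (det-charMatrix-orphan (3 + (b + a)) (roles₁ a) leaf₂-centre₂ (pendantRole-leaf₂ a (b + a) (ℕₚ.m≤n+m a b))
      (layout-absent leaf₂-centre₂ _ a ((λ ()) ∷ (λ ()) ∷ (λ ()) ∷ [])))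
    ih (χ₁-step-b a b))

det-roles₂ : ∀ a b → det (charMatrix {3 + (b + a)} (roles₂ a)) ≈ χ₂ a b
det-roles₂ = ℕ²-induction (≡⇒≈ refl)
  (λ a ih → orphan-recurrence
    (det-charMatrix-orphan (3 + a) (roles₂ (suc a)) leaf₁-centre₁ (pendantRole-leaf₁ (suc a) a (ℕₚ.n<1+n a))
      (layout-absent leaf₁-centre₁ _ (suc a) ((λ ()) ∷ (λ ()) ∷ (λ ()) ∷ [])))
    (≈-trans (det-layout-suc (leaf₁ ∷ centre₂ ∷ leaf₂ ∷ []) a) ih) (χ₂-step-a a 0))
  (λ a b ih → leaf-recurrence
    (det-charMatrix-leaf (2 + (b + a)) (roles₂ a) (suc zero) leaf₂-centre₂
      (pendantRole-leaf₂ a (b + a) (ℕₚ.m≤n+m a b)) refl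
      (layout-unique leaf₂-centre₂ (leaf₁ ∷ []) (leaf₂ ∷ []) a ((λ ()) ∷ []) ((λ ()) ∷ [])))
    ih
    (≈-trans (det-layout-punchIn {2 + (b + a)} (leaf₁ ∷ []) centre₂ (leaf₂ ∷ []) a) (det-roles₀ a b))
    (χ₂-step-b a b))

det-roles₁₂ : ∀ a b → det (charMatrix {4 + (b + a)} (roles₁₂ a)) ≈ specPoly a b
det-roles₁₂ = ℕ²-induction (≡⇒≈ refl)
  (λ a ih → leaf-recurrence
    (det-charMatrix-leaf (3 + a) (roles₁₂ (suc a)) (suc zero) leaf₁-centre₁
      (pendantRole-leaf₁ (suc a) a (ℕₚ.n<1+n a)) refl
      (layout-unique leaf₁-centre₁ (leaf₁ ∷ []) (centre₂ ∷ leaf₂ ∷ []) (suc a) ((λ ()) ∷ []) ((λ ()) ∷ (λ ()) ∷ [])))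
    (≈-trans (det-layout-suc (leaf₁ ∷ centre₁ ∷ centre₂ ∷ leaf₂ ∷ []) a) ih)
    (≈-trans (det-layout-punchIn {3 + a} (leaf₁ ∷ []) centre₁ (centre₂ ∷ leaf₂ ∷ []) (suc a))
      (≈-trans (det-layout-suc (leaf₁ ∷ centre₂ ∷ leaf₂ ∷ []) a) (det-roles₂ a 0)))
    (specPoly-step-a a 0))
  (λ a b ih → leaf-recurrence
    (det-charMatrix-leaf (3 + (b + a)) (roles₁₂ a) (suc (suc zero)) leaf₂-centre₂
      (pendantRole-leaf₂ a (b + a) (ℕₚ.m≤n+m a b)) refl
      (layout-unique leaf₂-centre₂ (leaf₁ ∷ centre₁ ∷ []) (leaf₂ ∷ []) a ((λ ()) ∷ (λ ()) ∷ []) ((λ ()) ∷ [])))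
    ih
    (≈-trans (det-layout-punchIn {3 + (b + a)} (leaf₁ ∷ centre₁ ∷ []) centre₂ (leaf₂ ∷ []) a) (det-roles₁ a b))
    (specPoly-step-b a b))

-- Walks and distances

module Walks {n} (G : Graph n) where

  reach-refl : ∀ u → reach G 0 u u ≡ true
  reach-refl = ==-refl

  reach-step : ∀ k u w v → reach G k u w ≡ true → G w v ≡ true → reach G (suc k) u v ≡ true
  reach-step k u w v uw wv with reach G k u v
  ... | true  = refl
  ... | false = anyF-true (λ w′ → reach G k u w′ ∧ G w′ v) w (cong₂ _∧_ uw wv)

  walk₁ : ∀ {u v} → G u v ≡ true → reach G 1 u v ≡ true
  walk₁ {u} {v} uv = reach-step 0 u u v (reach-refl u) uv

  walk₂ : ∀ {u v} w → G u w ≡ true → G w v ≡ true → reach G 2 u v ≡ true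
  walk₂ {u} {v} w uw wv = reach-step 1 u w v (walk₁ uw) wv

  walk₃ : ∀ {u v} w₁ w₂ → G u w₁ ≡ true → G w₁ w₂ ≡ true → G w₂ v ≡ true → reach G 3 u v ≡ true
  walk₃ {u} {v} w₁ w₂ uw₁ w₁w₂ w₂v = reach-step 2 u w₂ v (walk₂ w₁ uw₁ w₁w₂) w₂v

  reach-suc : ∀ k u v → reach G k u v ≡ true → reach G (suc k) u v ≡ true
  reach-suc k u v e = cong (_∨ anyF (λ w → reach G k u w ∧ G w v)) e

  reach-mono : ∀ {j k} u v → j ≤ k → reach G j u v ≡ true → reach G k u v ≡ true
  reach-mono {j} {k} u v j≤k e = subst (λ i → reach G i u v ≡ true) (ℕₚ.m∸n+n≡m j≤k) (extend (k ∸ j))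
    where
    extend : ∀ d → reach G (d + j) u v ≡ true
    extend zero    = e
    extend (suc d) = reach-suc (d + j) u v (extend d)

  unreach-mono : ∀ {j k} u v → j ≤ k → reach G k u v ≡ false → reach G j u v ≡ false
  unreach-mono {j} u v j≤k e with reach G j u v in ej
  ... | false = refl
  ... | true  = trans (sym (reach-mono u v j≤k ej)) e

  reach-1 : ∀ {u w} → reach G 1 u w ≡ true → u ≡ w ⊎ G u w ≡ true
  reach-1 {u} {w} e with u == w in u==w
  ... | true = inj₁ (==⇒≡ {u = u} {v = w} u==w)
  ... | false with anyF-witness (λ w′ → (u == w′) ∧ G w′ w) e
  ...   | w′ , e′ with ==⇒≡ {u = u} {v = w′} (Boolₚ.∧-conicalˡ (u == w′) (G w′ w) e′)
  ...     | refl = inj₂ (Boolₚ.∧-conicalʳ (u == u) (G u w) e′)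

  unreach-0 : ∀ {u v} → u ≢ v → reach G 0 u v ≡ false
  unreach-0 = ≢⇒==-false

  unreach-1 : ∀ {u v} → u ≢ v → G u v ≡ false → reach G 1 u v ≡ false
  unreach-1 {u} {v} u≢v uv = trans (cong (_∨ anyF (λ w → (u == w) ∧ G w v)) (unreach-0 u≢v)) (anyF-false _ no-step)
    where
    no-step : ∀ w → ((u == w) ∧ G w v) ≡ false
    no-step w with u == w in u==w
    ... | false = refl
    ... | true with ==⇒≡ {u = u} {v = w} u==w
    ...   | refl = uv

  unreach-2 : ∀ {u v} → u ≢ v → G u v ≡ false → (∀ w → G u w ≡ true → G w v ≡ false) →
    reach G 2 u v ≡ false
  unreach-2 {u} {v} u≢v uv far = trans (cong (_∨ anyF (λ w → reach G 1 u w ∧ G w v)) (unreach-1 u≢v uv))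
    (anyF-false _ no-step)
    where
    no-step : ∀ w → (reach G 1 u w ∧ G w v) ≡ false
    no-step w with reach G 1 u w in uw
    ... | false = refl
    ... | true with reach-1 {u} {w} uw
    ...   | inj₁ refl = uv
    ...   | inj₂ uw′  = far w uw′

dist-self : ∀ {n} (G : Graph (suc n)) u → dist G u u ≡ 0
dist-self {n} G u = search-least (λ k → reach G k u u) n 0 (λ _ ()) (==-refl u) z≤n

dist-exact : ∀ {n} (G : Graph (suc n)) {u v} d → d ≤ n → reach G d u v ≡ true →
  reach G (pred d) u v ≡ false → dist G u v ≡ d
dist-exact {n} G {u} {v} d d≤n reach-d unreach-pred =
  search-least (λ k → reach G k u v) n d
    (λ j j<d → Walks.unreach-mono G u v (ℕₚ.<⇒≤pred j<d) unreach-pred) reach-d d≤n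

module RoleGraph {r} (G : Graph (4 + r)) (role : Fin (4 + r) → Role)
  (vertexOf : Role → Fin (4 + r)) (role-vertexOf : ∀ t → role (vertexOf t) ≡ t)
  (G-role : ∀ u v → G u v ≡ not (u == v) ∧ not (adjacentᵀ (role u) (role v))) where

  open Walks G

  edge : ∀ {u v} → u ≢ v → adjacentᵀ (role u) (role v) ≡ false → G u v ≡ true
  edge {u} {v} u≢v e = trans (G-role u v) (cong₂ (λ x y → not x ∧ not y) (≢⇒==-false u≢v) e)

  non-edge : ∀ {u v} → adjacentᵀ (role u) (role v) ≡ true → G u v ≡ false
  non-edge {u} {v} e =
    trans (G-role u v) (trans (cong (λ y → not (u == v) ∧ not y) e) (Boolₚ.∧-zeroʳ (not (u == v))))

  edge⇒non-adjacentᵀ : ∀ {u v} → G u v ≡ true → adjacentᵀ (role u) (role v) ≡ false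
  edge⇒non-adjacentᵀ {u} {v} uv with adjacentᵀ (role u) (role v) in e
  ... | false = refl
  ... | true  = trans (sym uv) (non-edge {u} {v} e)

  edge-roles : ∀ {u v t s} → role u ≡ t → role v ≡ s → t ≢ s → adjacentᵀ t s ≡ false → G u v ≡ true
  edge-roles refl refl t≢s e = edge (λ { refl → t≢s refl }) e

  reach-link : ∀ {u v} → u ≢ v → (l : Link (role u) (role v)) → reach G (linkLength l) u v ≡ true
  reach-link u≢v (direct e) = walk₁ (edge u≢v e)
  reach-link u≢v (via m _ t≢m m≢s e₁ e₂) = walk₂ (vertexOf m)
    (edge-roles refl (role-vertexOf m) t≢m e₁) (edge-roles (role-vertexOf m) refl m≢s e₂)
  reach-link u≢v (via₂ m₁ m₂ _ _ t≢m₁ m₁≢m₂ m₂≢s e₁ e₂ e₃) = walk₃ (vertexOf m₁) (vertexOf m₂)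
    (edge-roles refl (role-vertexOf m₁) t≢m₁ e₁) (edge-roles (role-vertexOf m₁) (role-vertexOf m₂) m₁≢m₂ e₂)
    (edge-roles (role-vertexOf m₂) refl m₂≢s e₃)

  unreach-link : ∀ {u v} → u ≢ v → (l : Link (role u) (role v)) → reach G (pred (linkLength l)) u v ≡ false
  unreach-link u≢v (direct _)                  = unreach-0 u≢v
  unreach-link u≢v (via _ adj _ _ _ _)         = unreach-1 u≢v (non-edge adj)
  unreach-link u≢v (via₂ _ _ adj far _ _ _ _ _ _) =
    unreach-2 u≢v (non-edge adj) λ w uw → non-edge (far (role w) (edge⇒non-adjacentᵀ uw))

  dist-distinct : ∀ {u v} → u ≢ v → dist G u v ≡ roleDist (role u) (role v)
  dist-distinct {u} {v} u≢v = dist-exact G (linkLength l) (ℕₚ.≤-trans (linkLength≤3 l) (ℕₚ.m≤m+n 3 r))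
    (reach-link u≢v l) (unreach-link u≢v l)
    where l = link (role u) (role v)

  ecc-role : ∀ u → ecc G u ≡ roleEcc (role u)
  ecc-role u = maxF-attained (dist G u) w bound attained
    where
    w = vertexOf (farthest (role u))
    u≢w : u ≢ w
    u≢w u≡w = farthest≢ (role u) (trans (cong role u≡w) (role-vertexOf _))
    bound : ∀ v → dist G u v ≤ roleEcc (role u)
    bound v with u Fin.≟ v
    ... | yes refl = subst (_≤ roleEcc (role u)) (sym (dist-self G u)) z≤n
    ... | no  u≢v  = subst (_≤ roleEcc (role u)) (sym (dist-distinct u≢v)) (roleDist≤roleEcc _ _)
    attained : dist G u w ≡ roleEcc (role u)
    attained = trans (dist-distinct u≢w)
      (trans (cong (roleDist (role u)) (role-vertexOf _)) (roleDist-farthest (role u)))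

  eccMatrix-self : ∀ u → eccMatrix G u u ≡ 0
  eccMatrix-self u rewrite dist-self G u = Boolₚ.if-eta (0 ≡ᵇ (ecc G u ⊓ ecc G u))

  eccMatrix-distinct : ∀ {u v} → u ≢ v → eccMatrix G u v ≡ weight (role u) (role v)
  eccMatrix-distinct {u} {v} u≢v = cong₂ (λ d e → if d ≡ᵇ e then d else 0)
    (dist-distinct u≢v) (cong₂ _⊓_ (ecc-role u) (ecc-role v))

  connected-G : connected G
  connected-G u v with u Fin.≟ v
  ... | yes refl = reach-mono {k = 4 + r} u u z≤n (reach-refl u)
  ... | no  u≢v  = reach-mono {k = 4 + r} u v (ℕₚ.≤-trans (linkLength≤3 l) (ℕₚ.m≤m+n 3 (suc r)))
                     (reach-link u≢v l)
    where l = link (role u) (role v)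

-- The tree T and its complement

-- T3 a b with the vertex count left free, so that it can be transported to 4 + (b + a).
treeGraph : ℕ → ℕ → ∀ {m} → Graph m
treeGraph a b u v = treeEdge a b (toℕ u) (toℕ v) ∨ treeEdge a b (toℕ v) (toℕ u)

adjacentᵀ-sym : ∀ t s → adjacentᵀ t s ≡ adjacentᵀ s t
adjacentᵀ-sym t s = Boolₚ.∨-comm (arcᵀ t s) (arcᵀ s t)

treeEdge-pendant : ∀ a b (i : Fin 4) t → t <ℕ a + b →
  treeEdge a b (toℕ i) (4 + t) ∨ treeEdge a b (4 + t) (toℕ i) ≡ adjacentᵀ (roles₁₂ a (toℕ i)) (pendantRole a t)
treeEdge-pendant a b zero t _ with t <ᵇ a
... | true  = refl
... | false = refl
treeEdge-pendant a b (suc zero) t _ with t <ᵇ a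
... | true  = refl
... | false = refl
treeEdge-pendant a b (suc (suc zero)) t t<a+b with t <ᵇ a in t<ᵇa
... | true  rewrite ≤⇒<ᵇ≡false (<ᵇ≡true⇒< t a t<ᵇa) = refl
... | false rewrite <⇒<ᵇ≡true (s≤s (<ᵇ≡false⇒≤ t a t<ᵇa)) | <⇒<ᵇ≡true t<a+b = refl
treeEdge-pendant a b (suc (suc (suc zero))) t _ with t <ᵇ a
... | true  = refl
... | false = refl

treeEdge-pendantˡ : ∀ a b (i : Fin 4) t → t <ℕ a + b →
  treeEdge a b (4 + t) (toℕ i) ∨ treeEdge a b (toℕ i) (4 + t) ≡ adjacentᵀ (pendantRole a t) (roles₁₂ a (toℕ i))
treeEdge-pendantˡ a b i t t< =
  trans (Boolₚ.∨-comm (treeEdge a b (4 + t) (toℕ i)) (treeEdge a b (toℕ i) (4 + t)))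
        (trans (treeEdge-pendant a b i t t<) (adjacentᵀ-sym (roles₁₂ a (toℕ i)) (pendantRole a t)))

treeEdge-roles : ∀ a b i j → i <ℕ 4 + (a + b) → j <ℕ 4 + (a + b) →
  treeEdge a b i j ∨ treeEdge a b j i ≡ adjacentᵀ (roles₁₂ a i) (roles₁₂ a j)
treeEdge-roles a b 0 0 _ _ = refl
treeEdge-roles a b 0 1 _ _ = refl
treeEdge-roles a b 0 2 _ _ = refl
treeEdge-roles a b 0 3 _ _ = refl
treeEdge-roles a b 1 0 _ _ = refl
treeEdge-roles a b 1 1 _ _ = refl
treeEdge-roles a b 1 2 _ _ = refl
treeEdge-roles a b 1 3 _ _ = refl
treeEdge-roles a b 2 0 _ _ = refl
treeEdge-roles a b 2 1 _ _ = refl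
treeEdge-roles a b 2 2 _ _ = refl
treeEdge-roles a b 2 3 _ _ = refl
treeEdge-roles a b 3 0 _ _ = refl
treeEdge-roles a b 3 1 _ _ = refl
treeEdge-roles a b 3 2 _ _ = refl
treeEdge-roles a b 3 3 _ _ = refl
treeEdge-roles a b (suc (suc (suc (suc s)))) (suc (suc (suc (suc t)))) _ _ with s <ᵇ a | t <ᵇ a
... | true  | true  = refl
... | true  | false = refl
... | false | true  = refl
... | false | false = refl
treeEdge-roles a b 0 (suc (suc (suc (suc t)))) _ (s≤s (s≤s (s≤s (s≤s t<)))) = treeEdge-pendant a b zero t t<
treeEdge-roles a b 1 (suc (suc (suc (suc t)))) _ (s≤s (s≤s (s≤s (s≤s t<)))) = treeEdge-pendant a b (suc zero) t t<
treeEdge-roles a b 2 (suc (suc (suc (suc t)))) _ (s≤s (s≤s (s≤s (s≤s t<)))) = treeEdge-pendant a b (suc (suc zero)) t t<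
treeEdge-roles a b 3 (suc (suc (suc (suc t)))) _ (s≤s (s≤s (s≤s (s≤s t<)))) = treeEdge-pendant a b (suc (suc (suc zero))) t t<
treeEdge-roles a b (suc (suc (suc (suc s)))) 0 (s≤s (s≤s (s≤s (s≤s s<)))) _ = treeEdge-pendantˡ a b zero s s<
treeEdge-roles a b (suc (suc (suc (suc s)))) 1 (s≤s (s≤s (s≤s (s≤s s<)))) _ = treeEdge-pendantˡ a b (suc zero) s s<
treeEdge-roles a b (suc (suc (suc (suc s)))) 2 (s≤s (s≤s (s≤s (s≤s s<)))) _ = treeEdge-pendantˡ a b (suc (suc zero)) s s<
treeEdge-roles a b (suc (suc (suc (suc s)))) 3 (s≤s (s≤s (s≤s (s≤s s<)))) _ = treeEdge-pendantˡ a b (suc (suc (suc zero))) s s<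

module _ (a b : ℕ) where

  roleᵀ : Fin (4 + (b + a)) → Role
  roleᵀ u = roles₁₂ a (toℕ u)

  vertexᵀ : Role → Fin (4 + (b + a))
  vertexᵀ leaf₁   = zero
  vertexᵀ centre₁ = suc zero
  vertexᵀ centre₂ = suc (suc zero)
  vertexᵀ leaf₂   = suc (suc (suc zero))

  roleᵀ-vertexᵀ : ∀ t → roleᵀ (vertexᵀ t) ≡ t
  roleᵀ-vertexᵀ leaf₁   = refl
  roleᵀ-vertexᵀ centre₁ = refl
  roleᵀ-vertexᵀ centre₂ = refl
  roleᵀ-vertexᵀ leaf₂   = refl

  complement-roleᵀ : ∀ u v → complement (treeGraph a b) u v ≡ not (u == v) ∧ not (adjacentᵀ (roleᵀ u) (roleᵀ v))
  complement-roleᵀ u v = cong (λ e → not (u == v) ∧ not e)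
    (treeEdge-roles a b (toℕ u) (toℕ v) (bound u) (bound v))
    where
    bound : ∀ (w : Fin (4 + (b + a))) → toℕ w <ℕ 4 + (a + b)
    bound w = subst (λ k → toℕ w <ℕ 4 + k) (ℕₚ.+-comm b a) (Finₚ.toℕ<n w)

  open RoleGraph (complement (treeGraph a b)) roleᵀ vertexᵀ roleᵀ-vertexᵀ complement-roleᵀ

  complement-connected : connected (complement (treeGraph a b {4 + (b + a)}))
  complement-connected = connected-G

  charPolyEntry : Bool → ℕ → Poly
  charPolyEntry b e = if b then ℤ.- + e ∷ + 1 ∷ [] else ℤ.- + e ∷ []

  charPolyEntry-eccMatrix : ∀ u v →
    charPolyEntry (u == v) (eccMatrix (complement (treeGraph a b)) u v) ≡ charMatrix (roles₁₂ a) u v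
  charPolyEntry-eccMatrix u v with u Fin.≟ v
  ... | yes refl = trans (cong₂ charPolyEntry (==-refl u) (eccMatrix-self u))
                         (sym (charMatrix-diagonal (roles₁₂ a) u))
  ... | no  u≢v  = trans (cong₂ charPolyEntry (≢⇒==-false u≢v) (eccMatrix-distinct u≢v))
                         (cong (λ b → charEntry b (roleᵀ u) (roleᵀ v)) (sym (≢⇒==-false u≢v)))

  charPoly-complement : charPoly (ecc-matrix-ℤ (complement (treeGraph a b {4 + (b + a)}))) ≈ specPoly a b
  charPoly-complement = ≈-trans (det-≡ charPolyEntry-eccMatrix) (det-roles₁₂ a b)

disc-sym : ∀ a b → disc a b ≡ disc b a
disc-sym a b = cong₂ (λ n m → + n ℤ.* + n ℤ.- + m)
  (cong (λ k → 4 * (k + 4) + 1) (ℕₚ.+-comm a b)) (cong (64 *_) (ℕₚ.*-comm (suc a) (suc b)))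

-- With b = a + d, (4n+1)² − 64(a+1)(b+1) = 16d² + 144a + 72d + 225.
disc-positive-≤ : ∀ a b → a ≤ b → + 0 < disc a b
disc-positive-≤ a b a≤b = subst (+ 0 <_) (sym disc≡) (ℤ.+<+ (s≤s z≤n))
  where
  d = b ∸ a
  N = 4 * (a + b + 4) + 1
  Y = 64 * (suc a * suc b)
  K = 16 * d * d + 144 * a + 72 * d + 224
  square : N * N ≡ Y + suc K
  square = subst (λ b → (4 * (a + b + 4) + 1) * (4 * (a + b + 4) + 1) ≡ 64 * (suc a * suc b) + suc K)
    (ℕₚ.m+[n∸m]≡n a≤b)
    (solve 2 (λ a d → (con 4 :* (a :+ (a :+ d) :+ con 4) :+ con 1) :* (con 4 :* (a :+ (a :+ d) :+ con 4) :+ con 1)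
                   := con 64 :* ((con 1 :+ a) :* (con 1 :+ (a :+ d)))
                      :+ (con 1 :+ (con 16 :* d :* d :+ con 144 :* a :+ con 72 :* d :+ con 224))) refl a d)
    where open ℕ-Solver.+-*-Solver
  disc≡ : disc a b ≡ + suc K
  disc≡ = begin
    + N ℤ.* + N ℤ.- + Y        ≡⟨ cong (ℤ._- + Y) (ℤₚ.pos-* N N) ⟨
    + (N * N) ℤ.- + Y          ≡⟨ cong (λ t → + t ℤ.- + Y) square ⟩
    + (Y + suc K) ℤ.- + Y      ≡⟨ cong (ℤ._- + Y) (ℤₚ.pos-+ Y (suc K)) ⟩
    (+ Y ℤ.+ + suc K) ℤ.- + Y  ≡⟨ ℤ-Solver.+-*-Solver.solve 2 (λ y k → (y :+ k) :- y := k) refl (+ Y) (+ suc K) ⟩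
    + suc K                    ∎
    where
    open ≡-Reasoning
    open ℤ-Solver.+-*-Solver using (_:+_; _:-_; _:=_)

disc-positive : ∀ a b → + 0 < disc a b
disc-positive a b with ℕₚ.≤-total a b
... | inj₁ a≤b = disc-positive-≤ a b a≤b
... | inj₂ b≤a = subst (+ 0 <_) (disc-sym b a) (disc-positive-≤ b a b≤a)

-- The assumption a ≤ b only fixes which centre is called v₁; nothing depends on it.
lemma2p3 : (a b : ℕ) → a ≤ b →
    connected (complement (T3 a b))
    × (∀ (i : ℕ) → coeff (charPoly (ecc-matrix-ℤ (complement (T3 a b)))) i ≡ coeff (specPoly a b) i)
    × (+ 0 < disc a b)
lemma2p3 a b _ =
  let connected-T , charPoly-T = transport (trans (ℕₚ.+-comm (a + b) 4) (cong (λ k → 4 + k) (ℕₚ.+-comm a b)))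
  in  connected-T , charPoly-T , disc-positive a b
  where
  transport : ∀ {m} → m ≡ 4 + (b + a) → connected (complement (treeGraph a b {m}))
    × (∀ i → coeff (charPoly (ecc-matrix-ℤ (complement (treeGraph a b {m})))) i ≡ coeff (specPoly a b) i)
  transport refl = complement-connected a b , at (charPoly-complement a b)
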